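{- Let $n\ge 3$, $s\ge 1$, $r\ge 1$ be integers with $r>3s(n-1)$ and let $G_{n,s,r}$ be the plane graph constructed in the context. Let $a,b$ be two shallow faces of $G_{n,s,r}$ and let $v_a,v_b$ be their closest grid vertices, and let $d$ be the distance between $v_a$ and $v_b$ in the grid $G_n$. Then the distance between $v_a$ and $v_b$ in $G_{n,s,r}$ is at most $(2s+1)d$ (so a robber moving along edges of $G_{n,s,r}$ can go from $v_a$ to $v_b$ in at most $(2s+1)d$ steps), while the distance between $a$ and $b$ in the dual graph of $G_{n,s,r}$ is at least $3s(d-2)$ (so a cop moving between adjacent faces needs at least $3s(d-2)$ steps to go from $a$ to $b$).
   Context: Construction of $G_{n,s,r}$: Let $G_n$ be the $n\times n$ grid graph, embedded in the plane so that its inner faces are the $4$-cycles; its outer face has length $4(n-1)$. Its vertices are called grid vertices. Subdivide every edge of $G_n$ by $2s$ new vertices (subdivision vertices) to obtain the plane graph $G_{n,s}$; each inner face of $G_{n,s}$ has $8s$ subdivision vertices on its boundary and the outer face has $8s(n-1)$. Inside each face $f$ of $G_{n,s}$ having $x$ subdivision vertices on its boundary, add $r$ pairwise nested cycles (rings), each of length $\tfrac32 x$, all nested with the boundary cycle of $f$ and lying in the region of $f$; between any two consecutive rings add a planar perfect matching of $\tfrac32 x$ edges. The closest ring of an inner face $f$ is its outermost ring; the closest ring of the outer face is its innermost ring. Finally add, without crossings, edges between each subdivision vertex $v$ and vertices of the closest rings of the two faces of $G_{n,s}$ incident to $v$, such that: each vertex of a closest ring is joined to exactly one subdivision vertex;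 each subdivision vertex is joined to two closest-ring vertices in one of its two incident faces of $G_{n,s}$ and to one closest-ring vertex in the other; and the side receiving two edges alternates along each path of subdivision vertices. The resulting plane graph is $G_{n,s,r}$. A face of $G_{n,s,r}$ is shallow if its boundary contains some subdivision vertex, and deep otherwise. For a face $f$ of $G_{n,s,r}$, its closest grid vertex $v_f$ is a grid vertex closest to $f$ (i.e. minimizing the graph distance in $G_{n,s,r}$ to the boundary vertices of $f$), ties broken arbitrarily. The dual graph of $G_{n,s,r}$ has the faces of $G_{n,s,r}$ as vertices, two faces being adjacent when they share an edge. -}

module Defs where

open import Data.Nat using (ℕ; zero; suc; _+_; _*_; _∸_; _≤_; _<_)
open import Data.Bool using (Bool; true; false; not; _xor_)
open import Data.Product using (_×_; _,_; proj₁; proj₂; ∃; ∃-syntax)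
open import Data.Sum using (_⊎_)
open import Relation.Binary.PropositionalEquality using (_≡_)

data Walk {A : Set} (R : A → A → Set) : A → A → ℕ → Set where
  []  : ∀ {x} → Walk R x x 0
  _∷_ : ∀ {x y z k} → R x y → Walk R y z k → Walk R x z (suc k)

Sym : {A : Set} → (A → A → Set) → A → A → Set
Sym R x y = R x y ⊎ R y x

IsDist : {A : Set} → (A → A → Set) → A → A → ℕ → Set
IsDist R x y d = Walk R x y d × (∀ k → Walk R x y k → d ≤ k)

-- The grid G_n.  Grid vertex (i , j) with i , j < n  (i = row, j = column).
-- h i j : horizontal edge (i , j) -- (i , j+1)
-- v i j : vertical edge   (i , j) -- (i+1 , j)

data GE : Set where
  h v : ℕ → ℕ → GE

start end : GE → ℕ × ℕ
start (h i j) = i , j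
start (v i j) = i , j
end (h i j) = i , suc j
end (v i j) = suc i , j

data ValidGE (n : ℕ) : GE → Set where
  vh : ∀ {i j} → i < n → suc j < n → ValidGE n (h i j)
  vv : ∀ {i j} → suc i < n → j < n → ValidGE n (v i j)

data GridE (n : ℕ) : ℕ × ℕ → ℕ × ℕ → Set where
  ge : ∀ {e} → ValidGE n e → GridE n (start e) (end e)

GridAdj : ℕ → ℕ × ℕ → ℕ × ℕ → Set
GridAdj n = Sym (GridE n)

ValidGrid : ℕ → ℕ × ℕ → Set
ValidGrid n g = proj₁ g < n × proj₂ g < n

-- Faces of G_n (equivalently of G_{n,s}): inner face (i , j) is the square
-- with corners (i,j),(i,j+1),(i+1,j+1),(i+1,j) ; plus the outer face.
data GF : Set where
  inner : ℕ → ℕ → GF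
  outer : GF

-- Direction in which a face boundary traverses an edge
-- (fwd = from start e to end e).  Inner faces are traversed
-- counterclockwise, the outer face clockwise, so every edge is traversed
-- fwd by one incident face and bwd by the other.
data Dir : Set where
  fwd bwd : Dir

segEnd : Dir → GE → ℕ × ℕ
segEnd fwd e = end e
segEnd bwd e = start e

data OnBd (n : ℕ) : GF → GE → Dir → Set where
  in-b  : ∀ {i j} → suc i < n → suc j < n → OnBd n (inner i j) (h i j) fwd
  in-r  : ∀ {i j} → suc i < n → suc j < n → OnBd n (inner i j) (v i (suc j)) fwd
  in-t  : ∀ {i j} → suc i < n → suc j < n → OnBd n (inner i j) (h (suc i) j) bwd
  in-l  : ∀ {i j} → suc i < n → suc j < n → OnBd n (inner i j) (v i j) bwd
  out-l : ∀ {i} → suc i < n → OnBd n outer (v i 0) fwd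
  out-t : ∀ {j} → suc j < n → OnBd n outer (h (n ∸ 1) j) fwd
  out-r : ∀ {i} → suc i < n → OnBd n outer (v i (n ∸ 1)) bwd
  out-b : ∀ {j} → suc j < n → OnBd n outer (h 0 j) bwd

data NextSeg (n : ℕ) : GF → GE → Dir → GE → Dir → Set where
  in-br  : ∀ {i j} → suc i < n → suc j < n →
           NextSeg n (inner i j) (h i j) fwd (v i (suc j)) fwd
  in-rt  : ∀ {i j} → suc i < n → suc j < n →
           NextSeg n (inner i j) (v i (suc j)) fwd (h (suc i) j) bwd
  in-tl  : ∀ {i j} → suc i < n → suc j < n →
           NextSeg n (inner i j) (h (suc i) j) bwd (v i j) bwd
  in-lb  : ∀ {i j} → suc i < n → suc j < n →
           NextSeg n (inner i j) (v i j) bwd (h i j) fwd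
  ol-step : ∀ {i} → suc (suc i) < n → NextSeg n outer (v i 0) fwd (v (suc i) 0) fwd
  ol-turn : NextSeg n outer (v (n ∸ 2) 0) fwd (h (n ∸ 1) 0) fwd
  ot-step : ∀ {j} → suc (suc j) < n →
            NextSeg n outer (h (n ∸ 1) j) fwd (h (n ∸ 1) (suc j)) fwd
  ot-turn : NextSeg n outer (h (n ∸ 1) (n ∸ 2)) fwd (v (n ∸ 2) (n ∸ 1)) bwd
  or-step : ∀ {i} → suc (suc i) < n →
            NextSeg n outer (v (suc i) (n ∸ 1)) bwd (v i (n ∸ 1)) bwd
  or-turn : NextSeg n outer (v 0 (n ∸ 1)) bwd (h 0 (n ∸ 2)) bwd
  ob-step : ∀ {j} → suc (suc j) < n → NextSeg n outer (h 0 (suc j)) bwd (h 0 j) bwd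
  ob-turn : NextSeg n outer (h 0 0) bwd (v 0 0) fwd

isEven : ℕ → Bool
isEven zero = true
isEven (suc k) = not (isEven k)

-- two φ d e k : does subdivision vertex k of edge e send two edges into the
-- incident face traversing e in direction d?  Alternates along the path;
-- φ e fixes the (arbitrary) phase on each path.
two : (GE → Bool) → Dir → GE → ℕ → Bool
two φ fwd e k = φ e xor isEven k
two φ bwd e k = not (φ e xor isEven k)

-- Vertices of G_{n,s,r}
--   grid g          : grid vertex
--   sub e k         : k-th subdivision vertex on e (k < 2s, counted from start e)
--   ring f ρ e k c  : vertex of the ρ-th ring of face f (ρ = 0 the closest ring)
--                     at the position of sub e k ; c = false its first vertex,
--                     c = true its second one (only if sub e k sends two edges to f).
data V : Set where
  grid : ℕ × ℕ → V
  sub  : GE → ℕ → V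
  ring : GF → ℕ → GE → ℕ → Bool → V

-- Faces of G_{n,s,r}
--   tri f e k      : triangle  sub e k , its two ring-0 neighbours in f
--   gap f e k      : face between sub e k and the next subdivision vertex on the
--                    boundary of f (through the corner grid vertex if any)
--   quad f ρ e k c : face between ring ρ and ring ρ+1 starting at position (e,k,c)
--   center f       : the face bounded by ring r-1 of f only
data Face : Set where
  tri gap : GF → GE → ℕ → Face
  quad    : GF → ℕ → GE → ℕ → Bool → Face
  center  : GF → Face

module Constr (n s r : ℕ) (φ : GE → Bool) where

  fst lst : Dir → ℕ
  fst fwd = 0
  fst bwd = 2 * s ∸ 1
  lst fwd = 2 * s ∸ 1
  lst bwd = 0

  data NextSub (f : GF) : GE → ℕ → GE → ℕ → Set where
    ns-f : ∀ {e k} → OnBd n f e fwd → suc k < 2 * s → NextSub f e k e (suc k)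
    ns-b : ∀ {e k} → OnBd n f e bwd → suc k < 2 * s → NextSub f e (suc k) e k
    ns-c : ∀ {e d e' d'} → NextSeg n f e d e' d' → NextSub f e (lst d) e' (fst d')

  data RPos (f : GF) : GE → ℕ → Bool → Set where
    rpos1 : ∀ {e d k} → OnBd n f e d → k < 2 * s → RPos f e k false
    rpos2 : ∀ {e d k} → OnBd n f e d → k < 2 * s → two φ d e k ≡ true → RPos f e k true

  data RSucc (f : GF) : GE → ℕ → Bool → GE → ℕ → Bool → Set where
    rs-in  : ∀ {e d k} → OnBd n f e d → k < 2 * s → two φ d e k ≡ true →
             RSucc f e k false e k true
    rs-out : ∀ {e d k e' k' c} → NextSub f e k e' k' → OnBd n f e d → two φ d e k ≡ c →
             RSucc f e k c e' k' false

  data E : V → V → Set where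
    e-start : ∀ {e} → ValidGE n e → E (grid (start e)) (sub e 0)
    e-path  : ∀ {e k} → ValidGE n e → suc k < 2 * s → E (sub e k) (sub e (suc k))
    e-end   : ∀ {e} → ValidGE n e → E (sub e (2 * s ∸ 1)) (grid (end e))
    e-ring  : ∀ {f ρ e k c e' k' c'} → ρ < r → RSucc f e k c e' k' c' →
              E (ring f ρ e k c) (ring f ρ e' k' c')
    e-match : ∀ {f ρ e k c} → suc ρ < r → RPos f e k c →
              E (ring f ρ e k c) (ring f (suc ρ) e k c)
    e-att   : ∀ {f e k c} → RPos f e k c → E (sub e k) (ring f 0 e k c)

  Adj : V → V → Set
  Adj = Sym E

  data FE : Face → V → V → Set where
    fe-tri1 : ∀ {f e d k} → OnBd n f e d → k < 2 * s → two φ d e k ≡ true →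
              FE (tri f e k) (sub e k) (ring f 0 e k false)
    fe-tri2 : ∀ {f e d k} → OnBd n f e d → k < 2 * s → two φ d e k ≡ true →
              FE (tri f e k) (ring f 0 e k false) (ring f 0 e k true)
    fe-tri3 : ∀ {f e d k} → OnBd n f e d → k < 2 * s → two φ d e k ≡ true →
              FE (tri f e k) (ring f 0 e k true) (sub e k)
    fe-gap1 : ∀ {f e d k e' k'} → NextSub f e k e' k' → OnBd n f e d →
              FE (gap f e k) (sub e k) (ring f 0 e k (two φ d e k))
    fe-gap2 : ∀ {f e d k e' k'} → NextSub f e k e' k' → OnBd n f e d →
              FE (gap f e k) (ring f 0 e k (two φ d e k)) (ring f 0 e' k' false)
    fe-gap3 : ∀ {f e k e' k'} → NextSub f e k e' k' →
              FE (gap f e k) (ring f 0 e' k' false) (sub e' k')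
    fe-gapf : ∀ {f e k} → OnBd n f e fwd → suc k < 2 * s →
              FE (gap f e k) (sub e k) (sub e (suc k))
    fe-gapb : ∀ {f e k} → OnBd n f e bwd → suc k < 2 * s →
              FE (gap f e (suc k)) (sub e (suc k)) (sub e k)
    fe-gapc1 : ∀ {f e d e' d'} → NextSeg n f e d e' d' →
               FE (gap f e (lst d)) (sub e (lst d)) (grid (segEnd d e))
    fe-gapc2 : ∀ {f e d e' d'} → NextSeg n f e d e' d' →
               FE (gap f e (lst d)) (grid (segEnd d e)) (sub e' (fst d'))
    fe-q1 : ∀ {f ρ e k c e' k' c'} → suc ρ < r → RSucc f e k c e' k' c' →
            FE (quad f ρ e k c) (ring f ρ e k c) (ring f ρ e' k' c')
    fe-q2 : ∀ {f ρ e k c e' k' c'} → suc ρ < r → RSucc f e k c e' k' c' →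
            FE (quad f ρ e k c) (ring f (suc ρ) e k c) (ring f (suc ρ) e' k' c')
    fe-q3 : ∀ {f ρ e k c e' k' c'} → suc ρ < r → RSucc f e k c e' k' c' →
            FE (quad f ρ e k c) (ring f ρ e k c) (ring f (suc ρ) e k c)
    fe-q4 : ∀ {f ρ e k c e' k' c'} → suc ρ < r → RSucc f e k c e' k' c' →
            FE (quad f ρ e k c) (ring f ρ e' k' c') (ring f (suc ρ) e' k' c')
    fe-c  : ∀ {f e k c e' k' c'} → RSucc f e k c e' k' c' →
            FE (center f) (ring f (r ∸ 1) e k c) (ring f (r ∸ 1) e' k' c')

  OnF : Face → V → V → Set
  OnF F = Sym (FE F)

  OnBoundary : Face → V → Set
  OnBoundary F x = ∃[ y ] OnF F x y

  Shallow : Face → Set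
  Shallow F = ∃[ e ] ∃[ k ] OnBoundary F (sub e k)

  DualAdj : Face → Face → Set
  DualAdj F G = ∃[ x ] ∃[ y ] (OnF F x y × OnF G x y)

  ReachBd : ℕ × ℕ → Face → ℕ → Set
  ReachBd g F k = ∃[ x ] ∃[ k' ] (OnBoundary F x × k' ≤ k × Walk Adj (grid g) x k')

  Closest : Face → ℕ × ℕ → Set
  Closest F g = ValidGrid n g ×
    (∀ g' → ValidGrid n g' → ∀ k → ReachBd g' F k → ReachBd g F k)

-- Robber: every edge of G_n becomes a path of 2s + 1 edges of G_{n,s,r}.
--
-- Cop: pick signs so that the height h(i, j) = ±i ± j drops by the Manhattan distance D ≥ d from v_a to
-- v_b, scaled by 3s (the number of closest-ring vertices along one side of a face of G_n). Each ring vertex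
-- sits at a position along a side of its face of G_n and inherits a height from it. A shallow face gets the
-- height of a vertex of its closest ring; a face between rings ρ and ρ + 1 gets that height clamped to the
-- interval of radius r - 1 - ρ around the centre of its face of G_n; the central face gets the centre. Two
-- faces sharing an edge then lie in a common window [l, l + 1], so this potential changes by at most 1 along
-- dual walks (r > 3s(n - 1) makes the clamping vacuous on the closest rings). Doubled heights change by at
-- most 3 along edges of G_{n,s,r}, so a shallow face is within 3s of its closest grid vertex, and a dual walk
-- from a to b has length at least 3s·D - 6s.

module Submission where

open import Defs
open import Data.Nat using (ℕ; zero; suc; z≤n; s≤s; _+_; _*_; _∸_; _≤_; _<_; ∣_-_∣; _≡ᵇ_; _<ᵇ_)
import Data.Nat as ℕ
import Data.Nat.Properties as ℕₚ
open import Data.Nat.Tactic.RingSolver using () renaming (solve-∀ to ℕ-solve)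
open import Data.Integer as ℤ using (ℤ; +_; -_; 0ℤ; 1ℤ; _-_; _⊓_; _⊔_)
import Data.Integer.Properties as ℤₚ
open import Data.Integer.Tactic.RingSolver using (solve-∀)
open import Data.Bool using (Bool; true; false; not; _∧_; if_then_else_)
open import Data.Bool.Properties using (not-distribʳ-xor; ∧-inverseʳ; ∧-identityʳ)
open import Data.Product using (_×_; _,_; proj₁; proj₂; ∃; ∃-syntax)
open import Data.Sign using (Sign)
open import Data.Sum using (_⊎_; inj₁; inj₂)
open import Function using (_∘_)
open import Relation.Binary.PropositionalEquality
open import Relation.Nullary using (yes; no)

∸-suc : ∀ m ρ → suc ρ ≤ m → m ∸ ρ ≡ suc (m ∸ suc ρ)
∸-suc (suc m) zero    _       = refl
∸-suc (suc m) (suc ρ) (s≤s p) = ∸-suc m ρ p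

≡ᵇ-refl : ∀ i → (i ≡ᵇ i) ≡ true
≡ᵇ-refl zero    = refl
≡ᵇ-refl (suc i) = ≡ᵇ-refl i

suc-≡ᵇ : ∀ i → (suc i ≡ᵇ i) ≡ false
suc-≡ᵇ zero    = refl
suc-≡ᵇ (suc i) = suc-≡ᵇ i

≡ᵇ-suc : ∀ i → (i ≡ᵇ suc i) ≡ false
≡ᵇ-suc zero    = refl
≡ᵇ-suc (suc i) = ≡ᵇ-suc i

pos-≡ᵇ-0 : ∀ {x} → 1 ≤ x → (x ≡ᵇ 0) ≡ false
pos-≡ᵇ-0 (s≤s _) = refl

<ᵇ-suc : ∀ i → (i <ᵇ suc i) ≡ true
<ᵇ-suc zero    = refl
<ᵇ-suc (suc i) = <ᵇ-suc i

suc-<ᵇ : ∀ i → (suc i <ᵇ i) ≡ false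
suc-<ᵇ zero    = refl
suc-<ᵇ (suc i) = suc-<ᵇ i

module _ {A : Set} {R : A → A → Set} where

  walk-snoc : ∀ {x y z k} → Walk R x y k → R y z → Walk R x z (suc k)
  walk-snoc []      e = e ∷ []
  walk-snoc (e ∷ w) f = e ∷ walk-snoc w f

  infixr 5 _++ʷ_
  _++ʷ_ : ∀ {x y z k m} → Walk R x y k → Walk R y z m → Walk R x z (k + m)
  []      ++ʷ w = w
  (e ∷ p) ++ʷ w = e ∷ (p ++ʷ w)

walk-reverse : ∀ {A : Set} {R : A → A → Set} {x y k} → Walk (Sym R) x y k → Walk (Sym R) y x k
walk-reverse []           = []
walk-reverse (inj₁ e ∷ w) = walk-snoc (walk-reverse w) (inj₂ e)
walk-reverse (inj₂ e ∷ w) = walk-snoc (walk-reverse w) (inj₁ e)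

walk-lift : ∀ {A B : Set} {R : A → A → Set} {S : B → B → Set} (f : A → B) {ℓ} →
            (∀ {x y} → R x y → Walk S (f x) (f y) ℓ) →
            ∀ {x y d} → Walk R x y d → Walk S (f x) (f y) (d * ℓ)
walk-lift f lift []      = []
walk-lift f lift (e ∷ w) = lift e ++ʷ walk-lift f lift w

module _ {A : Set} {R : A → A → Set} (pt : ℕ → A) {N : ℕ}
         (step : ∀ {x} → suc x < N → R (pt x) (pt (suc x))) where

  walk-up : ∀ a m → m + a < N → Walk R (pt a) (pt (m + a)) m
  walk-up a zero    _ = []
  walk-up a (suc m) p = walk-snoc (walk-up a m (ℕₚ.<-trans (ℕₚ.n<1+n _) p)) (step p)

  walk-between : ∀ {a b} → a ≤ b → b < N → Walk R (pt a) (pt b) (b ∸ a)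
  walk-between {a} {b} a≤b b<N =
    subst (λ c → Walk R (pt a) (pt c) (b ∸ a)) b∸a+a≡b
      (walk-up a (b ∸ a) (subst (_< N) (sym b∸a+a≡b) b<N))
    where
    b∸a+a≡b : b ∸ a + a ≡ b
    b∸a+a≡b = ℕₚ.m∸n+n≡m a≤b

walk-segment : ∀ {A : Set} {R : A → A → Set} (pt : ℕ → A) {N : ℕ} →
               (∀ {x} → suc x < N → R (pt x) (pt (suc x))) →
               ∀ {a b} → a < N → b < N → Walk (Sym R) (pt a) (pt b) ∣ a - b ∣
walk-segment {R = R} pt step {a} {b} a<N b<N with ℕₚ.≤-total a b
... | inj₁ a≤b = subst (Walk (Sym R) (pt a) (pt b)) (sym (ℕₚ.m≤n⇒∣m-n∣≡n∸m a≤b))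
                   (walk-between pt (inj₁ ∘ step) a≤b b<N)
... | inj₂ b≤a = subst (Walk (Sym R) (pt a) (pt b)) (sym (ℕₚ.m≤n⇒∣n-m∣≡n∸m b≤a))
                   (walk-reverse (walk-between pt (inj₁ ∘ step) b≤a a<N))

-- Integers at bounded distance

Near : ℕ → ℤ → ℤ → Set
Near m a b = a ℤ.≤ b ℤ.+ + m × b ℤ.≤ a ℤ.+ + m

near-refl : ∀ m a → Near m a a
near-refl m a = ℤₚ.i≤i+j a (+ m) , ℤₚ.i≤i+j a (+ m)

near-sym : ∀ {m a b} → Near m a b → Near m b a
near-sym (p , q) = q , p

near-weaken : ∀ {m m' a b} → m ≤ m' → Near m a b → Near m' a b
near-weaken {m} {m'} {a} {b} m≤m' (p , q) = widen {a} {b} p , widen {b} {a} q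
  where
  widen : ∀ {x y} → x ℤ.≤ y ℤ.+ + m → x ℤ.≤ y ℤ.+ + m'
  widen {y = y} p = ℤₚ.≤-trans p (ℤₚ.+-monoʳ-≤ y (ℤ.+≤+ m≤m'))

+-pos-assoc : ∀ a i j → a ℤ.+ + i ℤ.+ + j ≡ a ℤ.+ + (i + j)
+-pos-assoc a i j = trans (ℤₚ.+-assoc a (+ i) (+ j)) (cong (λ t → a ℤ.+ t) (sym (ℤₚ.pos-+ i j)))

near-trans : ∀ {m m' x y z} → Near m x y → Near m' y z → Near (m + m') x z
near-trans {m} {m'} {x} {y} {z} (p₁ , p₂) (q₁ , q₂) =
  ℤₚ.≤-trans p₁ (ℤₚ.≤-trans (ℤₚ.+-monoˡ-≤ (+ m) q₁)
    (ℤₚ.≤-reflexive (trans (+-pos-assoc z m' m) (cong (λ t → z ℤ.+ + t) (ℕₚ.+-comm m' m))))) ,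
  ℤₚ.≤-trans q₂ (ℤₚ.≤-trans (ℤₚ.+-monoˡ-≤ (+ m') p₂) (ℤₚ.≤-reflexive (+-pos-assoc x m m')))

near-+ˡ : ∀ {m x y} c → Near m x y → Near m (c ℤ.+ x) (c ℤ.+ y)
near-+ˡ {m} {x} {y} c (p , q) =
  ℤₚ.≤-trans (ℤₚ.+-monoʳ-≤ c p) (ℤₚ.≤-reflexive (sym (ℤₚ.+-assoc c y (+ m)))) ,
  ℤₚ.≤-trans (ℤₚ.+-monoʳ-≤ c q) (ℤₚ.≤-reflexive (sym (ℤₚ.+-assoc c x (+ m))))

near-+ʳ-cancel : ∀ {m x y} c → Near m (x ℤ.+ c) (y ℤ.+ c) → Near m x y
near-+ʳ-cancel {m} {x} {y} c (p , q) = cancel {x} {y} p , cancel {y} {x} q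
  where
  cancel : ∀ {a b} → a ℤ.+ c ℤ.≤ b ℤ.+ c ℤ.+ + m → a ℤ.≤ b ℤ.+ + m
  cancel {a} {b} le =
    ℤₚ.≤-trans (ℤₚ.≤-reflexive (sym (l₁ a c)))
      (ℤₚ.≤-trans (ℤₚ.+-monoˡ-≤ (- c) le) (ℤₚ.≤-reflexive (l₂ b c (+ m))))
    where
    l₁ : ∀ a c → a ℤ.+ c ℤ.+ - c ≡ a
    l₁ = solve-∀
    l₂ : ∀ b c m → b ℤ.+ c ℤ.+ m ℤ.+ - c ≡ b ℤ.+ m
    l₂ = solve-∀

near-scale : ∀ c {m x y} → Near m x y → Near (c * m) (+ c ℤ.* x) (+ c ℤ.* y)
near-scale c {m} {x} {y} (p , q) = scale {x} {y} p , scale {y} {x} q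
  where
  scale : ∀ {a b} → a ℤ.≤ b ℤ.+ + m → + c ℤ.* a ℤ.≤ + c ℤ.* b ℤ.+ + (c * m)
  scale {a} {b} le =
    ℤₚ.≤-trans (ℤₚ.*-monoˡ-≤-nonNeg (+ c) le)
      (ℤₚ.≤-reflexive (trans (ℤₚ.*-distribˡ-+ (+ c) b (+ m))
                             (cong (λ t → + c ℤ.* b ℤ.+ t) (sym (ℤₚ.pos-* c m)))))

near-between : ∀ {m x y z c} → Near m x c → Near m y c → x ℤ.≤ z → z ℤ.≤ y → Near m z c
near-between {m} (_ , x₂) (y₁ , _) x≤z z≤y = ℤₚ.≤-trans z≤y y₁ , ℤₚ.≤-trans x₂ (ℤₚ.+-monoˡ-≤ (+ m) x≤z)

near-offset : ∀ {m} a b j → j ≤ m → b ≡ a + j → Near m (+ a) (+ b)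
near-offset {m} a .(a + j) j j≤m refl =
  ℤ.+≤+ (ℕₚ.≤-trans (ℕₚ.m≤m+n a j) (ℕₚ.m≤m+n _ m)) , ℤ.+≤+ (ℕₚ.+-monoʳ-≤ a j≤m)

+c-distrib-⊓ : ∀ c i j → (i ⊓ j) ℤ.+ c ≡ (i ℤ.+ c) ⊓ (j ℤ.+ c)
+c-distrib-⊓ c = ℤₚ.mono-≤-distrib-⊓ (ℤₚ.+-monoˡ-≤ c)

+c-distrib-⊔ : ∀ c i j → (i ⊔ j) ℤ.+ c ≡ (i ℤ.+ c) ⊔ (j ℤ.+ c)
+c-distrib-⊔ c = ℤₚ.mono-≤-distrib-⊔ (ℤₚ.+-monoˡ-≤ c)

near-⊓ : ∀ {m a a' b b'} → Near m a a' → Near m b b' → Near m (a ⊓ b) (a' ⊓ b')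
near-⊓ {m} {a} {a'} {b} {b'} (p₁ , p₂) (q₁ , q₂) =
  ℤₚ.≤-trans (ℤₚ.⊓-mono-≤ p₁ q₁) (ℤₚ.≤-reflexive (sym (+c-distrib-⊓ (+ m) a' b'))) ,
  ℤₚ.≤-trans (ℤₚ.⊓-mono-≤ p₂ q₂) (ℤₚ.≤-reflexive (sym (+c-distrib-⊓ (+ m) a b)))

near-⊔ : ∀ {m a a' b b'} → Near m a a' → Near m b b' → Near m (a ⊔ b) (a' ⊔ b')
near-⊔ {m} {a} {a'} {b} {b'} (p₁ , p₂) (q₁ , q₂) =
  ℤₚ.≤-trans (ℤₚ.⊔-mono-≤ p₁ q₁) (ℤₚ.≤-reflexive (sym (+c-distrib-⊔ (+ m) a' b'))) ,
  ℤₚ.≤-trans (ℤₚ.⊔-mono-≤ p₂ q₂) (ℤₚ.≤-reflexive (sym (+c-distrib-⊔ (+ m) a b)))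

near-+ : ∀ {m m' a b c d} → Near m a b → Near m' c d → Near (m + m') (a ℤ.+ c) (b ℤ.+ d)
near-+ {m} {m'} {a} {b} {c} {d} (p₁ , p₂) (q₁ , q₂) =
  ℤₚ.≤-trans (ℤₚ.+-mono-≤ p₁ q₁) (ℤₚ.≤-reflexive (regroup b d)) ,
  ℤₚ.≤-trans (ℤₚ.+-mono-≤ p₂ q₂) (ℤₚ.≤-reflexive (regroup a c))
  where
  regroup : ∀ x y → x ℤ.+ + m ℤ.+ (y ℤ.+ + m') ≡ x ℤ.+ y ℤ.+ + (m + m')
  regroup x y = trans (l x y (+ m) (+ m')) (cong (λ t → x ℤ.+ y ℤ.+ t) (sym (ℤₚ.pos-+ m m')))
    where l : ∀ x y m m' → x ℤ.+ m ℤ.+ (y ℤ.+ m') ≡ x ℤ.+ y ℤ.+ (m ℤ.+ m')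
          l = solve-∀

+-cancelˡ-≤ : ∀ x {a b} → x ℤ.+ a ℤ.≤ x ℤ.+ b → a ℤ.≤ b
+-cancelˡ-≤ x {a} {b} le =
  subst₂ ℤ._≤_ (l x a) (l x b) (ℤₚ.+-monoʳ-≤ (- x) le)
  where l : ∀ x a → - x ℤ.+ (x ℤ.+ a) ≡ a
        l = solve-∀

near-cast : ∀ {m a a' b b'} → a ≡ a' → b ≡ b' → Near m (+ a) (+ b) → Near m (+ a') (+ b')
near-cast {m} = subst₂ (λ x y → Near m (+ x) (+ y))

walk-near : ∀ {A : Set} {R : A → A → Set} (f : A → ℤ) {m} →
            (∀ {x y} → R x y → Near m (f x) (f y)) →
            ∀ {x y k} → Walk R x y k → Near (k * m) (f x) (f y)
walk-near f {m} step []      = near-refl 0 _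
walk-near f {m} step (e ∷ w) = near-trans (step e) (walk-near f step w)

InWindow : ℤ → ℤ → Set
InWindow l p = l ℤ.≤ p × p ℤ.≤ l ℤ.+ 1ℤ

inWindow-refl : ∀ l → InWindow l l
inWindow-refl l = ℤₚ.≤-refl , ℤₚ.i≤i+j l 1ℤ

inWindow-near : ∀ {l a b} → InWindow l a → InWindow l b → Near 1 a b
inWindow-near (a₁ , a₂) (b₁ , b₂) =
  ℤₚ.≤-trans a₂ (ℤₚ.+-monoˡ-≤ 1ℤ b₁) , ℤₚ.≤-trans b₂ (ℤₚ.+-monoˡ-≤ 1ℤ a₁)

near⇒inWindow-⊓ : ∀ {x y} → Near 1 x y → InWindow (x ⊓ y) x × InWindow (x ⊓ y) y
near⇒inWindow-⊓ {x} {y} (x≤y+1 , y≤x+1) with ℤₚ.⊓-sel x y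
... | inj₁ x⊓y≡x rewrite x⊓y≡x = inWindow-refl x , (x≤y⊓ , y≤x+1)
  where
  x≤y⊓ : x ℤ.≤ y
  x≤y⊓ = subst (ℤ._≤ y) x⊓y≡x (ℤₚ.i⊓j≤j x y)
... | inj₂ x⊓y≡y rewrite x⊓y≡y = (y≤x⊓ , x≤y+1) , inWindow-refl y
  where
  y≤x⊓ : y ℤ.≤ x
  y≤x⊓ = subst (ℤ._≤ x) x⊓y≡y (ℤₚ.i⊓j≤i x y)

data IsUnit : ℤ → Set where
  unit⁺ : IsUnit 1ℤ
  unit⁻ : IsUnit (- 1ℤ)

isUnit-* : ∀ {u v} → IsUnit u → IsUnit v → IsUnit (u ℤ.* v)
isUnit-* unit⁺ unit⁺ = unit⁺
isUnit-* unit⁺ unit⁻ = unit⁻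
isUnit-* unit⁻ unit⁺ = unit⁻
isUnit-* unit⁻ unit⁻ = unit⁺

isUnit-neg : ∀ {u} → IsUnit u → IsUnit (- u)
isUnit-neg unit⁺ = unit⁻
isUnit-neg unit⁻ = unit⁺

near-unit-* : ∀ {u m p q} → IsUnit u → Near m p q → Near m (u ℤ.* p) (u ℤ.* q)
near-unit-* {m = m} {p} {q} unit⁺ pq rewrite ℤₚ.*-identityˡ p | ℤₚ.*-identityˡ q = pq
near-unit-* {m = m} {p} {q} unit⁻ (p≤q+m , q≤p+m)
  rewrite ℤₚ.-1*i≡-i p | ℤₚ.-1*i≡-i q = flip p q q≤p+m , flip q p p≤q+m
  where
  flip : ∀ a b → b ℤ.≤ a ℤ.+ + m → - a ℤ.≤ - b ℤ.+ + m
  flip a b le = ℤₚ.≤-trans (ℤₚ.≤-reflexive (neg-shift a (+ m))) (ℤₚ.+-monoˡ-≤ (+ m) (ℤₚ.neg-mono-≤ le))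
    where
    neg-shift : ∀ a m → - a ≡ - (a ℤ.+ m) ℤ.+ m
    neg-shift = solve-∀

near-unit-multiple : ∀ {u m} → IsUnit u → ∀ X j → j ≤ m → Near m X (X ℤ.+ u ℤ.* + j)
near-unit-multiple {u} uu X j j≤m =
  subst (λ Y → Near _ Y (X ℤ.+ u ℤ.* + j)) (trans (cong (λ t → X ℤ.+ t) (ℤₚ.*-zeroʳ u)) (ℤₚ.+-identityʳ X))
    (near-+ˡ X (near-unit-* uu (near-offset 0 j j j≤m refl)))

near-unit-step : ∀ {u} → IsUnit u → ∀ q → Near 1 q (q ℤ.+ u)
near-unit-step {u} uu q =
  subst (λ Y → Near 1 q (q ℤ.+ Y)) (ℤₚ.*-identityʳ u) (near-unit-multiple uu q 1 ℕₚ.≤-refl)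

near-unit-back : ∀ {u} → IsUnit u → ∀ q → Near 1 q (q - u)
near-unit-back uu = near-unit-step (isUnit-neg uu)

near-unit-between : ∀ {u m C} → IsUnit u → ∀ b t T → t ≤ T →
                    Near m b C → Near m (b ℤ.+ u ℤ.* + T) C → Near m (b ℤ.+ u ℤ.* + t) C
near-unit-between unit⁺ b t T t≤T p q rewrite ℤₚ.*-identityˡ (+ t) | ℤₚ.*-identityˡ (+ T) =
  near-between p q (ℤₚ.i≤i+j b (+ t)) (ℤₚ.+-monoʳ-≤ b (ℤ.+≤+ t≤T))
near-unit-between unit⁻ b t T t≤T p q rewrite ℤₚ.-1*i≡-i (+ t) | ℤₚ.-1*i≡-i (+ T) =
  near-between q p (ℤₚ.+-monoʳ-≤ b (ℤₚ.neg-mono-≤ (ℤ.+≤+ t≤T)))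
                   (ℤₚ.≤-trans (ℤₚ.+-monoʳ-≤ b (ℤₚ.neg-mono-≤ (ℤ.+≤+ z≤n))) (ℤₚ.≤-reflexive (ℤₚ.+-identityʳ b)))

⊓-unit : ∀ {u} → IsUnit u → ∀ q → q ≡ q ⊓ (q ℤ.+ u) ⊎ q ≡ q ⊓ (q ℤ.+ u) ℤ.+ 1ℤ
⊓-unit unit⁺ q = inj₁ (sym (ℤₚ.i≤j⇒i⊓j≡i (ℤₚ.i≤i+j q 1ℤ)))
⊓-unit unit⁻ q = inj₂ (trans (l₁ q) (cong (λ t → t ℤ.+ 1ℤ) (sym (ℤₚ.i≥j⇒i⊓j≡j q-1≤q))))
  where
  l₁ : ∀ q → q ≡ q ℤ.+ - 1ℤ ℤ.+ 1ℤ
  l₁ = solve-∀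
  q-1≤q : q ℤ.+ - 1ℤ ℤ.≤ q
  q-1≤q = subst (q ℤ.+ - 1ℤ ℤ.≤_) (sym (l₁ q)) (ℤₚ.i≤i+j _ 1ℤ)

⟦_⟧ : Sign → ℤ
⟦ σ ⟧ = σ ℤ.◃ 1

⟦⟧-unit : ∀ σ → IsUnit ⟦ σ ⟧
⟦⟧-unit Sign.+ = unit⁺
⟦⟧-unit Sign.- = unit⁻

-- Clamping

clamp : ℤ → ℤ → ℤ → ℤ
clamp lo hi x = lo ⊔ (hi ⊓ x)

clamp-mono : ∀ {lo lo' hi hi' x x'} → lo ℤ.≤ lo' → hi ℤ.≤ hi' → x ℤ.≤ x' →
             clamp lo hi x ℤ.≤ clamp lo' hi' x'
clamp-mono p q r = ℤₚ.⊔-mono-≤ p (ℤₚ.⊓-mono-≤ q r)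

clamp-+ : ∀ lo hi x c → clamp lo hi x ℤ.+ c ≡ clamp (lo ℤ.+ c) (hi ℤ.+ c) (x ℤ.+ c)
clamp-+ lo hi x c = trans (+c-distrib-⊔ c lo (hi ⊓ x)) (cong (λ t → (lo ℤ.+ c) ⊔ t) (+c-distrib-⊓ c hi x))

clamp-near : ∀ {m lo lo' hi hi' x x'} → Near m lo lo' → Near m hi hi' → Near m x x' →
             Near m (clamp lo hi x) (clamp lo' hi' x')
clamp-near p q r = near-⊔ p (near-⊓ q r)

clampAround : ℤ → ℕ → ℤ → ℤ
clampAround C w = clamp (C - + w) (C ℤ.+ + w)

clampAround-zero : ∀ C x → clampAround C 0 x ≡ C
clampAround-zero C x =
  trans (cong₂ (λ a b → a ⊔ (b ⊓ x)) (ℤₚ.+-identityʳ C) (ℤₚ.+-identityʳ C))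
        (ℤₚ.i≥j⇒i⊔j≡i (ℤₚ.i⊓j≤i C x))

clampAround-id : ∀ C w x → C - + w ℤ.≤ x → x ℤ.≤ C ℤ.+ + w → clampAround C w x ≡ x
clampAround-id C w x p q = trans (cong (λ t → (C - + w) ⊔ t) (ℤₚ.i≥j⇒i⊓j≡j q)) (ℤₚ.i≤j⇒i⊔j≡j p)

clampAround-mono : ∀ C w {x y} → x ℤ.≤ y → clampAround C w x ℤ.≤ clampAround C w y
clampAround-mono C w = clamp-mono ℤₚ.≤-refl ℤₚ.≤-refl

clampAround-near : ∀ C w {m x y} → Near m x y → Near m (clampAround C w x) (clampAround C w y)
clampAround-near C w = clamp-near (near-refl _ _) (near-refl _ _)

pos-suc : ∀ w → + suc w ≡ 1ℤ ℤ.+ + w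
pos-suc w = ℤₚ.pos-+ 1 w

clampAround-near-width : ∀ C w x → Near 1 (clampAround C w x) (clampAround C (suc w) x)
clampAround-near-width C w x = clamp-near lower upper (near-refl 1 x)
  where
  lower : Near 1 (C - + w) (C - + suc w)
  lower = subst (λ t → Near 1 (C - + w) (C - t)) (sym (pos-suc w))
            (subst (Near 1 (C - + w)) (l C (+ w)) (near-unit-back unit⁺ (C - + w)))
    where l : ∀ C w → C - w - 1ℤ ≡ C - (1ℤ ℤ.+ w)
          l = solve-∀
  upper : Near 1 (C ℤ.+ + w) (C ℤ.+ + suc w)
  upper = subst (λ t → Near 1 (C ℤ.+ + w) (C ℤ.+ t)) (sym (pos-suc w))
            (subst (Near 1 (C ℤ.+ + w)) (l C (+ w)) (near-unit-step unit⁺ (C ℤ.+ + w)))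
    where l : ∀ C w → C ℤ.+ w ℤ.+ 1ℤ ≡ C ℤ.+ (1ℤ ℤ.+ w)
          l = solve-∀

clampAround-step : ∀ C {w w'} x → w' ≤ suc w → w ≤ suc w' →
                   clampAround C w (x ℤ.+ 1ℤ) ℤ.≤ clampAround C w' x ℤ.+ 1ℤ
clampAround-step C {w} {w'} x w'≤1+w w≤1+w' =
  ℤₚ.≤-trans (clamp-mono lower upper ℤₚ.≤-refl)
             (ℤₚ.≤-reflexive (sym (clamp-+ (C - + w') (C ℤ.+ + w') x 1ℤ)))
  where
  lower : C - + w ℤ.≤ C - + w' ℤ.+ 1ℤ
  lower = subst₂ ℤ._≤_ (trans (cong (λ t → C ℤ.+ 1ℤ ℤ.+ - t) (pos-suc w)) (l₁ C (+ w))) (l₂ C (+ w'))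
            (ℤₚ.+-monoʳ-≤ (C ℤ.+ 1ℤ) (ℤₚ.neg-mono-≤ (ℤ.+≤+ w'≤1+w)))
    where
    l₁ : ∀ C w → C ℤ.+ 1ℤ ℤ.+ - (1ℤ ℤ.+ w) ≡ C - w
    l₁ = solve-∀
    l₂ : ∀ C w → C ℤ.+ 1ℤ ℤ.+ - w ≡ C - w ℤ.+ 1ℤ
    l₂ = solve-∀
  upper : C ℤ.+ + w ℤ.≤ C ℤ.+ + w' ℤ.+ 1ℤ
  upper = subst (C ℤ.+ + w ℤ.≤_) (l C (+ w'))
            (ℤₚ.+-monoʳ-≤ C (subst (+ w ℤ.≤_) (pos-suc w') (ℤ.+≤+ w≤1+w')))
    where
    l : ∀ C w → C ℤ.+ (1ℤ ℤ.+ w) ≡ C ℤ.+ w ℤ.+ 1ℤ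
    l = solve-∀

-- Values of consecutive ring vertices, clamped with consecutive widths, share a unit window.
clampAround-window : ∀ C w m q → (q ≡ m ⊎ q ≡ m ℤ.+ 1ℤ) →
  InWindow (clampAround C w m ⊓ clampAround C (suc w) m) (clampAround C w q) ×
  InWindow (clampAround C w m ⊓ clampAround C (suc w) m) (clampAround C (suc w) q)
clampAround-window C w m q (inj₁ refl) = near⇒inWindow-⊓ (clampAround-near-width C w m)
clampAround-window C w m q (inj₂ refl) =
  (ℤₚ.≤-trans (ℤₚ.i⊓j≤i A B) (clampAround-mono C w m≤m+1) ,
   below-both (clampAround-step C m (ℕₚ.n≤1+n w) (ℕₚ.n≤1+n w))
              (clampAround-step C m ℕₚ.≤-refl (ℕₚ.m≤n⇒m≤1+n (ℕₚ.n≤1+n w)))) ,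
  (ℤₚ.≤-trans (ℤₚ.i⊓j≤j A B) (clampAround-mono C (suc w) m≤m+1) ,
   below-both (clampAround-step C m (ℕₚ.m≤n⇒m≤1+n (ℕₚ.n≤1+n w)) ℕₚ.≤-refl)
              (clampAround-step C m (ℕₚ.n≤1+n _) (ℕₚ.n≤1+n _)))
  where
  A = clampAround C w m
  B = clampAround C (suc w) m
  m≤m+1 : m ℤ.≤ m ℤ.+ 1ℤ
  m≤m+1 = ℤₚ.i≤i+j m 1ℤ
  below-both : ∀ {X} → X ℤ.≤ A ℤ.+ 1ℤ → X ℤ.≤ B ℤ.+ 1ℤ → X ℤ.≤ (A ⊓ B) ℤ.+ 1ℤ
  below-both p q = ℤₚ.≤-trans (ℤₚ.⊓-glb p q) (ℤₚ.≤-reflexive (sym (+c-distrib-⊓ 1ℤ A B)))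

clampAround-near-id : ∀ {m C w x} → m ≤ w → Near m x C → clampAround C w x ≡ x
clampAround-near-id {m} {C} {w} {x} m≤w (x≤C+m , C≤x+m) = clampAround-id C w x lower upper
  where
  m≤w′ : + m ℤ.≤ + w
  m≤w′ = ℤ.+≤+ m≤w
  upper : x ℤ.≤ C ℤ.+ + w
  upper = ℤₚ.≤-trans x≤C+m (ℤₚ.+-monoʳ-≤ C m≤w′)
  lower : C - + w ℤ.≤ x
  lower = ℤₚ.≤-trans (ℤₚ.+-monoˡ-≤ (- + w) (ℤₚ.≤-trans C≤x+m (ℤₚ.+-monoʳ-≤ x m≤w′)))
                     (ℤₚ.≤-reflexive (l x (+ w)))
    where l : ∀ x w → x ℤ.+ w ℤ.+ - w ≡ x
          l = solve-∀

clampAround-window-unit : ∀ {u} → IsUnit u → ∀ C w q →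
  InWindow (clampAround C w (q ⊓ (q ℤ.+ u)) ⊓ clampAround C (suc w) (q ⊓ (q ℤ.+ u))) (clampAround C w q) ×
  InWindow (clampAround C w (q ⊓ (q ℤ.+ u)) ⊓ clampAround C (suc w) (q ⊓ (q ℤ.+ u))) (clampAround C (suc w) q)
clampAround-window-unit uu C w q = clampAround-window C w _ q (⊓-unit uu q)

-- Ring positions along an edge of the grid

toℕ : Bool → ℕ
toℕ true  = 1
toℕ false = 0

toℕ-≤1 : ∀ b → toℕ b ≤ 1
toℕ-≤1 true  = ℕₚ.≤-refl
toℕ-≤1 false = z≤n

toℕ-mono : ∀ {a b} → (a ≡ true → b ≡ true) → toℕ a ≤ toℕ b
toℕ-mono {false}          _   = z≤n
toℕ-mono {true}  {true}  _   = ℕₚ.≤-refl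
toℕ-mono {true}  {false} a⇒b with a⇒b refl
... | ()

toℕ-∧ : ∀ a b → toℕ (a ∧ b) ≤ toℕ a
toℕ-∧ true  b = toℕ-≤1 b
toℕ-∧ false b = z≤n

toℕ-+-not : ∀ b → toℕ b + toℕ (not b) ≡ 1
toℕ-+-not true  = refl
toℕ-+-not false = refl

module Positions (φ : GE → Bool) where

  two-suc : ∀ d e k → two φ d e (suc k) ≡ not (two φ d e k)
  two-suc fwd e k = sym (not-distribʳ-xor (φ e) (isEven k))
  two-suc bwd e k = cong not (sym (not-distribʳ-xor (φ e) (isEven k)))

  doubled : Dir → GE → ℕ → ℕ
  doubled d e zero    = 0
  doubled d e (suc k) = doubled d e k + toℕ (two φ d e k)

  ringsBefore : Dir → GE → ℕ → ℕ
  ringsBefore d e k = k + doubled d e k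

  -- Ring vertices are numbered by their position along e, counted from start e:
  -- 1, …, 3s on the forward side and 0, …, 3s - 1 on the backward side.
  ringPos : Dir → GE → ℕ → Bool → ℕ
  ringPos fwd e k c = suc (ringsBefore fwd e k + toℕ c)
  ringPos bwd e k c = ringsBefore bwd e k + toℕ (two φ bwd e k ∧ not c)

  doubled-sum : ∀ e k → doubled fwd e k + doubled bwd e k ≡ k
  doubled-sum e zero    = refl
  doubled-sum e (suc k) = begin
    (T + t) + (Tb + not-t) ≡⟨ interchange T t Tb not-t ⟩
    (T + Tb) + (t + not-t) ≡⟨ cong₂ _+_ (doubled-sum e k) (toℕ-+-not (two φ fwd e k)) ⟩
    k + 1                  ≡⟨ ℕₚ.+-comm k 1 ⟩
    suc k                  ∎
    where
    open ≡-Reasoning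
    T = doubled fwd e k
    Tb = doubled bwd e k
    t = toℕ (two φ fwd e k)
    not-t = toℕ (two φ bwd e k)
    interchange : ∀ a b c d → (a + b) + (c + d) ≡ (a + c) + (b + d)
    interchange = ℕ-solve

  doubled-+2 : ∀ d e k → doubled d e (suc (suc k)) ≡ suc (doubled d e k)
  doubled-+2 d e k = begin
    doubled d e k + t + toℕ (two φ d e (suc k)) ≡⟨ cong (λ b → doubled d e k + t + toℕ b) (two-suc d e k) ⟩
    doubled d e k + t + toℕ (not b)             ≡⟨ ℕₚ.+-assoc (doubled d e k) t _ ⟩
    doubled d e k + (t + toℕ (not b))           ≡⟨ cong (λ t′ → doubled d e k + t′) (toℕ-+-not b) ⟩
    doubled d e k + 1                           ≡⟨ ℕₚ.+-comm (doubled d e k) 1 ⟩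
    suc (doubled d e k)                         ∎
    where
    open ≡-Reasoning
    b = two φ d e k
    t = toℕ b

  doubled-even : ∀ d e m → doubled d e (2 * m) ≡ m
  doubled-even d e zero    = refl
  doubled-even d e (suc m) =
    trans (cong (doubled d e) (ℕₚ.*-suc 2 m)) (trans (doubled-+2 d e (2 * m)) (cong suc (doubled-even d e m)))

  -- Every second subdivision vertex is doubled towards a given side.
  doubled-half : ∀ d e k → Near 1 (+ (2 * doubled d e k)) (+ k)
  doubled-half d e zero          = near-refl 1 0ℤ
  doubled-half d e (suc zero)    with two φ d e 0
  ... | true  = near-sym (near-offset 1 2 1 ℕₚ.≤-refl refl)
  ... | false = near-offset 0 1 1 ℕₚ.≤-refl refl
  doubled-half d e (suc (suc k)) =
    subst (λ t → Near 1 (+ t) (+ suc (suc k)))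
          (trans (sym (ℕₚ.*-suc 2 (doubled d e k))) (cong (2 *_) (sym (doubled-+2 d e k))))
          (near-+ˡ (+ 2) (doubled-half d e k))

  ringsBefore-3s : ∀ d e s → ringsBefore d e (2 * s) ≡ 3 * s
  ringsBefore-3s d e s = trans (cong (λ t → 2 * s + t) (doubled-even d e s)) (l s)
    where l : ∀ s → 2 * s + s ≡ 3 * s
          l = ℕ-solve

  ringsBefore-mono : ∀ d e {k k'} → k ≤ k' → ringsBefore d e k ≤ ringsBefore d e k'
  ringsBefore-mono d e k≤k' = ℕₚ.+-mono-≤ k≤k' (doubled-mono (ℕₚ.≤⇒≤′ k≤k'))
    where
    doubled-mono : ∀ {k k'} → k ℕ.≤′ k' → doubled d e k ≤ doubled d e k'
    doubled-mono ℕ.≤′-refl       = ℕₚ.≤-refl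
    doubled-mono (ℕ.≤′-step k≤k') = ℕₚ.≤-trans (doubled-mono k≤k') (ℕₚ.m≤m+n _ _)

  ringPos-fwd-last : ∀ e k → ringPos fwd e k (two φ fwd e k) ≡ ringsBefore fwd e (suc k)
  ringPos-fwd-last e k = cong suc (ℕₚ.+-assoc k (doubled fwd e k) _)

  ringPos-bwd-last : ∀ e k → ringPos bwd e k (two φ bwd e k) ≡ ringsBefore bwd e k
  ringPos-bwd-last e k rewrite ∧-inverseʳ (two φ bwd e k) = ℕₚ.+-identityʳ _

  ringPos-bwd-first : ∀ e k → ringPos bwd e k false ≡ ringsBefore bwd e k + toℕ (two φ bwd e k)
  ringPos-bwd-first e k rewrite ∧-identityʳ (two φ bwd e k) = refl

  ringsBefore-bwd-suc : ∀ e k → ringsBefore bwd e (suc k) ≡ suc (ringPos bwd e k false)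
  ringsBefore-bwd-suc e k = cong suc (trans (sym (ℕₚ.+-assoc k (doubled bwd e k) _)) (sym (ringPos-bwd-first e k)))

  ringPos-≤ : ∀ s d e k c → suc k ≤ 2 * s → (c ≡ true → two φ d e k ≡ true) → ringPos d e k c ≤ 3 * s
  ringPos-≤ s fwd e k c k<2s c⇒two = begin
    suc (ringsBefore fwd e k + toℕ c)              ≤⟨ s≤s (ℕₚ.+-monoʳ-≤ _ (toℕ-mono c⇒two)) ⟩
    ringPos fwd e k (two φ fwd e k)               ≡⟨ ringPos-fwd-last e k ⟩
    ringsBefore fwd e (suc k)                     ≤⟨ ringsBefore-mono fwd e k<2s ⟩
    ringsBefore fwd e (2 * s)                     ≡⟨ ringsBefore-3s fwd e s ⟩
    3 * s                                         ∎
    where open ℕₚ.≤-Reasoning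
  ringPos-≤ s bwd e k c k<2s c⇒two = begin
    ringsBefore bwd e k + toℕ (two φ bwd e k ∧ not c) ≤⟨ ℕₚ.+-monoʳ-≤ _ (toℕ-∧ (two φ bwd e k) (not c)) ⟩
    ringsBefore bwd e k + toℕ (two φ bwd e k)         ≡⟨ sym (ringPos-bwd-first e k) ⟩
    ringPos bwd e k false                          <⟨ ℕₚ.n<1+n _ ⟩
    suc (ringPos bwd e k false)                    ≡⟨ sym (ringsBefore-bwd-suc e k) ⟩
    ringsBefore bwd e (suc k)                      ≤⟨ ringsBefore-mono bwd e k<2s ⟩
    ringsBefore bwd e (2 * s)                      ≡⟨ ringsBefore-3s bwd e s ⟩
    3 * s                                          ∎
    where open ℕₚ.≤-Reasoning

  near-bit-0 : ∀ b → Near 2 (+ 0) (+ (2 * toℕ b))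
  near-bit-0 true  = near-offset 0 2 2 ℕₚ.≤-refl refl
  near-bit-0 false = near-refl 2 0ℤ

  near-bit-2 : ∀ b → Near 2 (+ 2) (+ (2 * toℕ b))
  near-bit-2 true  = near-refl 2 (+ 2)
  near-bit-2 false = near-sym (near-offset 0 2 2 ℕₚ.≤-refl refl)

  -- Doubled heights: subdivision vertex k of an edge sits at 3k + 2, ring position p at 2p.
  attach-near : ∀ d e k c → Near 3 (+ (3 * k + 2)) (+ (2 * ringPos d e k c))
  attach-near fwd e k c =
    near-cast (l₁ k) (l₂ k (doubled fwd e k) (toℕ c))
      (near-+ˡ (+ (2 * k + 2)) (near-+ (near-sym (doubled-half fwd e k)) (near-bit-0 c)))
    where
    l₁ : ∀ k → 2 * k + 2 + (k + 0) ≡ 3 * k + 2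
    l₁ = ℕ-solve
    l₂ : ∀ k T x → 2 * k + 2 + (2 * T + 2 * x) ≡ 2 * suc (k + T + x)
    l₂ = ℕ-solve
  attach-near bwd e k c =
    near-cast (l₁ k) (l₂ k (doubled bwd e k) (toℕ (two φ bwd e k ∧ not c)))
      (near-+ˡ (+ (2 * k)) (near-+ (near-sym (doubled-half bwd e k)) (near-bit-2 (two φ bwd e k ∧ not c))))
    where
    l₁ : ∀ k → 2 * k + (k + 2) ≡ 3 * k + 2
    l₁ = ℕ-solve
    l₂ : ∀ k T y → 2 * k + (2 * T + 2 * y) ≡ 2 * (k + T + y)
    l₂ = ℕ-solve

  gap-fwd-near : ∀ e k → Near 3 (+ (2 * ringsBefore fwd e (suc k))) (+ (3 * suc k + 2))
  gap-fwd-near e k =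
    near-cast (l₁ (suc k) (doubled fwd e (suc k))) (l₂ (suc k))
      (near-+ˡ (+ (2 * suc k)) (near-+ (doubled-half fwd e (suc k)) (near-bit-0 true)))
    where
    l₁ : ∀ k T → 2 * k + (2 * T + 0) ≡ 2 * (k + T)
    l₁ = ℕ-solve
    l₂ : ∀ k → 2 * k + (k + 2) ≡ 3 * k + 2
    l₂ = ℕ-solve

  gap-bwd-near : ∀ e k → Near 3 (+ (2 * ringsBefore bwd e (suc k))) (+ (3 * k + 2))
  gap-bwd-near e k =
    near-weaken (ℕₚ.n≤1+n 2)
      (near-cast (l₁ (suc k) (doubled bwd e (suc k))) (l₂ k)
        (near-+ˡ (+ (2 * suc k))
          (near-trans (doubled-half bwd e (suc k)) (near-sym (near-offset k (suc k) 1 ℕₚ.≤-refl (ℕₚ.+-comm 1 k))))))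
    where
    l₁ : ∀ k T → 2 * k + 2 * T ≡ 2 * (k + T)
    l₁ = ℕ-solve
    l₂ : ∀ k → 2 * suc k + k ≡ 3 * k + 2
    l₂ = ℕ-solve

  across-near : ∀ e k → Near 1 (+ ringsBefore fwd e k) (+ ringsBefore bwd e k)
  across-near e k =
    near-+ˡ (+ k) (near-+ʳ-cancel {x = + T} {y = + doubled bwd e k} (+ T)
      (near-cast (l T) (trans (sym (doubled-sum e k)) (ℕₚ.+-comm T (doubled bwd e k))) (doubled-half fwd e k)))
    where
    T = doubled fwd e k
    l : ∀ T → 2 * T ≡ T + T
    l = ℕ-solve

module Boundary (n : ℕ) (2≤n : 2 ≤ n) where

  suc-∸1 : ∀ {x} → 1 ≤ x → suc (x ∸ 1) ≡ x
  suc-∸1 = ℕₚ.m+[n∸m]≡n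

  1≤n∸1 : 1 ≤ n ∸ 1
  1≤n∸1 = ℕₚ.∸-monoˡ-≤ 1 2≤n

  suc[n∸2]≡n∸1 : suc (n ∸ 2) ≡ n ∸ 1
  suc[n∸2]≡n∸1 = trans (cong suc (sym (ℕₚ.∸-+-assoc n 1 1))) (suc-∸1 1≤n∸1)

  n∸1<n : n ∸ 1 < n
  n∸1<n = ℕₚ.≤-reflexive (suc-∸1 (ℕₚ.≤-trans (s≤s z≤n) 2≤n))

  suc[n∸2]<n : suc (n ∸ 2) < n
  suc[n∸2]<n = subst (_< n) (sym suc[n∸2]≡n∸1) n∸1<n

  0<n : 0 < n
  0<n = ℕₚ.≤-trans (s≤s z≤n) 2≤n

  pred< : ∀ {i} → suc i < n → i < n
  pred< p = ℕₚ.<-trans (ℕₚ.n<1+n _) p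

  segStart : Dir → GE → ℕ × ℕ
  segStart fwd e = start e
  segStart bwd e = end e

  -- The direction in which face f traverses edge e (meaningful only when e lies on f).
  side : GF → GE → Dir
  side (inner i j) (h i' j') = if i' ≡ᵇ i then fwd else bwd
  side (inner i j) (v i' j') = if j' ≡ᵇ j then bwd else fwd
  side outer       (h i j)   = if i ≡ᵇ 0 then bwd else fwd
  side outer       (v i j)   = if j ≡ᵇ 0 then fwd else bwd

  side-correct : ∀ {f e d} → OnBd n f e d → side f e ≡ d
  side-correct (in-b {i} _ _)     rewrite ≡ᵇ-refl i = refl
  side-correct (in-r {i} {j} _ _) rewrite suc-≡ᵇ j = refl
  side-correct (in-t {i} _ _)     rewrite suc-≡ᵇ i = refl
  side-correct (in-l {i} {j} _ _) rewrite ≡ᵇ-refl j = refl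
  side-correct (out-l _)          = refl
  side-correct (out-t _)          rewrite pos-≡ᵇ-0 1≤n∸1 = refl
  side-correct (out-r _)          rewrite pos-≡ᵇ-0 1≤n∸1 = refl
  side-correct (out-b _)          = refl

  side-unique : ∀ {f e d d'} → OnBd n f e d → OnBd n f e d' → d ≡ d'
  side-unique p q = trans (sym (side-correct p)) (side-correct q)

  nextSeg-onBd : ∀ {f e d e' d'} → NextSeg n f e d e' d' → OnBd n f e d × OnBd n f e' d'
  nextSeg-onBd (in-br a b)  = in-b a b , in-r a b
  nextSeg-onBd (in-rt a b)  = in-r a b , in-t a b
  nextSeg-onBd (in-tl a b)  = in-t a b , in-l a b
  nextSeg-onBd (in-lb a b)  = in-l a b , in-b a b
  nextSeg-onBd (ol-step p)  = out-l (pred< p) , out-l p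
  nextSeg-onBd ol-turn      = out-l suc[n∸2]<n , out-t 2≤n
  nextSeg-onBd (ot-step p)  = out-t (pred< p) , out-t p
  nextSeg-onBd ot-turn      = out-t suc[n∸2]<n , out-r suc[n∸2]<n
  nextSeg-onBd (or-step p)  = out-r p , out-r (pred< p)
  nextSeg-onBd or-turn      = out-r 2≤n , out-b suc[n∸2]<n
  nextSeg-onBd (ob-step p)  = out-b p , out-b (pred< p)
  nextSeg-onBd ob-turn      = out-b 2≤n , out-l 2≤n

  nextSeg-corner : ∀ {f e d e' d'} → NextSeg n f e d e' d' → segEnd d e ≡ segStart d' e'
  nextSeg-corner (in-br a b) = refl
  nextSeg-corner (in-rt a b) = refl
  nextSeg-corner (in-tl a b) = refl
  nextSeg-corner (in-lb a b) = refl
  nextSeg-corner (ol-step p) = refl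
  nextSeg-corner ol-turn     = cong (_, 0) suc[n∸2]≡n∸1
  nextSeg-corner (ot-step p) = refl
  nextSeg-corner ot-turn     = cong₂ _,_ (sym suc[n∸2]≡n∸1) suc[n∸2]≡n∸1
  nextSeg-corner (or-step p) = refl
  nextSeg-corner or-turn     = cong (0 ,_) (sym suc[n∸2]≡n∸1)
  nextSeg-corner (ob-step p) = refl
  nextSeg-corner ob-turn     = refl

  onBd-valid : ∀ {f e d} → OnBd n f e d → ValidGE n e
  onBd-valid (in-b p q) = vh (pred< p) q
  onBd-valid (in-r p q) = vv p q
  onBd-valid (in-t p q) = vh p q
  onBd-valid (in-l p q) = vv p (pred< q)
  onBd-valid (out-l p)  = vv p 0<n
  onBd-valid (out-t p)  = vh n∸1<n p
  onBd-valid (out-r p)  = vv p n∸1<n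
  onBd-valid (out-b p)  = vh 0<n p

grid-path : ∀ {n} g g' → ValidGrid n g → ValidGrid n g' →
            Walk (GridAdj n) g g' (∣ proj₁ g - proj₁ g' ∣ + ∣ proj₂ g - proj₂ g' ∣)
grid-path (i , j) (i' , j') (i<n , j<n) (i'<n , j'<n) =
  walk-segment (λ x → x , j) (λ p → ge (vv p j<n)) i<n i'<n ++ʷ
  walk-segment (λ y → i' , y) (λ p → ge (vh i'<n p)) j<n j'<n

validStart : ∀ {n e} → ValidGE n e → ValidGrid n (start e)
validStart (vh p q) = p , ℕₚ.<-trans (ℕₚ.n<1+n _) q
validStart (vv p q) = ℕₚ.<-trans (ℕₚ.n<1+n _) p , q

validEnd : ∀ {n e} → ValidGE n e → ValidGrid n (end e)
validEnd (vh p q) = p , q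
validEnd (vv p q) = p , q

suc[2s∸1]≡2s : ∀ {s} → 1 ≤ s → suc (2 * s ∸ 1) ≡ 2 * s
suc[2s∸1]≡2s 1≤s = ℕₚ.m+[n∸m]≡n (ℕₚ.≤-trans 1≤s (ℕₚ.m≤m+n _ _))

module SubdividedWalks (n s r : ℕ) (φ : GE → Bool) (1≤s : 1 ≤ s) where
  open Constr n s r φ

  along : ∀ {e} → ValidGE n e → ∀ {a b} → a ≤ b → b < 2 * s → Walk Adj (sub e a) (sub e b) (b ∸ a)
  along {e} val = walk-between (sub e) (λ p → inj₁ (e-path val p))

  last<2s : 2 * s ∸ 1 < 2 * s
  last<2s = ℕₚ.≤-reflexive (suc[2s∸1]≡2s 1≤s)

  edge-walk : ∀ {e} → ValidGE n e → Walk Adj (grid (start e)) (grid (end e)) (2 * s + 1)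
  edge-walk val =
    subst (Walk Adj _ _) (trans (cong suc (suc[2s∸1]≡2s 1≤s)) (ℕₚ.+-comm 1 (2 * s)))
      (inj₁ (e-start val) ∷ walk-snoc (along val z≤n last<2s) (inj₁ (e-end val)))

  grid-walk-lift : ∀ {g g' d} → Walk (GridAdj n) g g' d → Walk Adj (grid g) (grid g') ((2 * s + 1) * d)
  grid-walk-lift {d = d} w = subst (Walk Adj _ _) (ℕₚ.*-comm d (2 * s + 1)) (walk-lift grid lift w)
    where
    lift : ∀ {x y} → GridAdj n x y → Walk Adj (grid x) (grid y) (2 * s + 1)
    lift (inj₁ (ge val)) = edge-walk val
    lift (inj₂ (ge val)) = walk-reverse (edge-walk val)

  nearby-grid : ∀ {e k} → ValidGE n e → suc k ≤ 2 * s →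
                ∃ λ g → ValidGrid n g × ∃ λ m → m ≤ s × Walk Adj (grid g) (sub e k) m
  nearby-grid {e} {k} val k<2s with k ℕ.<? s
  ... | yes k<s = start e , validStart val , suc k , k<s , inj₁ (e-start val) ∷ along val z≤n k<2s
  ... | no  k≮s = end e , validEnd val , suc (2 * s ∸ 1 ∸ k) , bound ,
                  walk-reverse (walk-snoc (along val k≤last last<2s) (inj₁ (e-end val)))
    where
    k≤last : k ≤ 2 * s ∸ 1
    k≤last = ℕₚ.∸-monoˡ-≤ 1 k<2s
    bound : suc (2 * s ∸ 1 ∸ k) ≤ s
    bound = begin
      suc (2 * s ∸ 1 ∸ k) ≡⟨ sym (ℕₚ.+-∸-assoc 1 k≤last) ⟩
      suc (2 * s ∸ 1) ∸ k ≡⟨ cong (_∸ k) (suc[2s∸1]≡2s 1≤s) ⟩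
      2 * s ∸ k           ≤⟨ ℕₚ.∸-monoʳ-≤ (2 * s) (ℕₚ.≮⇒≥ k≮s) ⟩
      2 * s ∸ s           ≡⟨ cong (_∸ s) (l s) ⟩
      s + s ∸ s           ≡⟨ ℕₚ.m+n∸n≡m s s ⟩
      s                   ∎
      where
      open ℕₚ.≤-Reasoning
      l : ∀ s → 2 * s ≡ s + s
      l = ℕ-solve

halfSum : Sign → Sign → ℤ
halfSum Sign.+ Sign.+ = 1ℤ
halfSum Sign.- Sign.- = - 1ℤ
halfSum _      _      = 0ℤ

private
  lo hi : ℕ → Sign → ℤ
  lo N Sign.+ = 0ℤ
  lo N Sign.- = - + N
  hi N Sign.+ = + N
  hi N Sign.- = 0ℤ

  signed-bounds : ∀ N σ i → i ≤ N → lo N σ ℤ.≤ ⟦ σ ⟧ ℤ.* + i × ⟦ σ ⟧ ℤ.* + i ℤ.≤ hi N σ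
  signed-bounds N Sign.+ i i≤N rewrite ℤₚ.*-identityˡ (+ i) = ℤ.+≤+ z≤n , ℤ.+≤+ i≤N
  signed-bounds N Sign.- i i≤N rewrite ℤₚ.-1*i≡-i (+ i) =
    ℤₚ.neg-mono-≤ (ℤ.+≤+ i≤N) , ℤₚ.neg-mono-≤ (ℤ.+≤+ z≤n)

  bounds-sum : ∀ N σ₁ σ₂ → lo N σ₁ ℤ.+ lo N σ₂ ≡ + N ℤ.* halfSum σ₁ σ₂ - + N
                         × hi N σ₁ ℤ.+ hi N σ₂ ≡ + N ℤ.* halfSum σ₁ σ₂ ℤ.+ + N
  bounds-sum N Sign.+ Sign.+ = l₁ (+ N) , l₂ (+ N)
    where l₁ : ∀ N → 0ℤ ℤ.+ 0ℤ ≡ N ℤ.* 1ℤ - N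
          l₁ = solve-∀
          l₂ : ∀ N → N ℤ.+ N ≡ N ℤ.* 1ℤ ℤ.+ N
          l₂ = solve-∀
  bounds-sum N Sign.+ Sign.- = l₁ (+ N) , l₂ (+ N)
    where l₁ : ∀ N → 0ℤ ℤ.+ - N ≡ N ℤ.* 0ℤ - N
          l₁ = solve-∀
          l₂ : ∀ N → N ℤ.+ 0ℤ ≡ N ℤ.* 0ℤ ℤ.+ N
          l₂ = solve-∀
  bounds-sum N Sign.- Sign.+ = l₁ (+ N) , l₂ (+ N)
    where l₁ : ∀ N → - N ℤ.+ 0ℤ ≡ N ℤ.* 0ℤ - N
          l₁ = solve-∀
          l₂ : ∀ N → 0ℤ ℤ.+ N ≡ N ℤ.* 0ℤ ℤ.+ N
          l₂ = solve-∀
  bounds-sum N Sign.- Sign.- = l₁ (+ N) , l₂ (+ N)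
    where l₁ : ∀ N → - N ℤ.+ - N ≡ N ℤ.* (- 1ℤ) - N
          l₁ = solve-∀
          l₂ : ∀ N → 0ℤ ℤ.+ 0ℤ ≡ N ℤ.* (- 1ℤ) ℤ.+ N
          l₂ = solve-∀

-- + N ℤ.* halfSum σ₁ σ₂ is the value of the signed sum at the centre of the square [0, N]².
signed-sum-near : ∀ N σ₁ σ₂ i j → i ≤ N → j ≤ N →
                  Near N (⟦ σ₁ ⟧ ℤ.* + i ℤ.+ ⟦ σ₂ ⟧ ℤ.* + j) (+ N ℤ.* halfSum σ₁ σ₂)
signed-sum-near N σ₁ σ₂ i j i≤N j≤N =
  ℤₚ.≤-trans (ℤₚ.+-mono-≤ (proj₂ bi) (proj₂ bj)) (ℤₚ.≤-reflexive (proj₂ (bounds-sum N σ₁ σ₂))) ,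
  ℤₚ.≤-trans (ℤₚ.≤-reflexive (l (+ N ℤ.* halfSum σ₁ σ₂) (+ N)))
    (ℤₚ.+-monoˡ-≤ (+ N) (ℤₚ.≤-trans (ℤₚ.≤-reflexive (sym (proj₁ (bounds-sum N σ₁ σ₂))))
                                    (ℤₚ.+-mono-≤ (proj₁ bi) (proj₁ bj))))
  where
  bi = signed-bounds N σ₁ i i≤N
  bj = signed-bounds N σ₂ j j≤N
  l : ∀ c N → c ≡ c - N ℤ.+ N
  l = solve-∀

module Potential (n s r : ℕ) (φ : GE → Bool) (σ₁ σ₂ : Sign)
                 (2≤n : 2 ≤ n) (1≤s : 1 ≤ s) (R<r : 3 * s * (n ∸ 1) < r) where
  open Constr n s r φ
  open Positions φ
  open Boundary n 2≤n

  height : ℕ × ℕ → ℤ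
  height (i , j) = ⟦ σ₁ ⟧ ℤ.* + i ℤ.+ ⟦ σ₂ ⟧ ℤ.* + j

  slope : GE → ℤ
  slope (h _ _) = ⟦ σ₂ ⟧
  slope (v _ _) = ⟦ σ₁ ⟧

  slope-unit : ∀ e → IsUnit (slope e)
  slope-unit (h _ _) = ⟦⟧-unit σ₂
  slope-unit (v _ _) = ⟦⟧-unit σ₁

  height-end : ∀ e → height (end e) ≡ height (start e) ℤ.+ slope e
  height-end (h i j) rewrite pos-suc j = l ⟦ σ₁ ⟧ ⟦ σ₂ ⟧ (+ i) (+ j)
    where l : ∀ a b i j → a ℤ.* i ℤ.+ b ℤ.* (1ℤ ℤ.+ j) ≡ a ℤ.* i ℤ.+ b ℤ.* j ℤ.+ b
          l = solve-∀
  height-end (v i j) rewrite pos-suc i = l ⟦ σ₁ ⟧ ⟦ σ₂ ⟧ (+ i) (+ j)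
    where l : ∀ a b i j → a ℤ.* (1ℤ ℤ.+ i) ℤ.+ b ℤ.* j ≡ a ℤ.* i ℤ.+ b ℤ.* j ℤ.+ a
          l = solve-∀

  -- Heights are scaled by 3s, the number of ring vertices of a face along one side of G_n.
  scaled : ℕ × ℕ → ℤ
  scaled g = + (3 * s) ℤ.* height g

  scaled-end : ∀ e → scaled (end e) ≡ scaled (start e) ℤ.+ slope e ℤ.* + (3 * s)
  scaled-end e rewrite height-end e = l (+ (3 * s)) (height (start e)) (slope e)
    where l : ∀ a b c → a ℤ.* (b ℤ.+ c) ≡ a ℤ.* b ℤ.+ c ℤ.* a
          l = solve-∀

  ringHeight : Dir → GE → ℕ → Bool → ℤ
  ringHeight d e k c = scaled (start e) ℤ.+ slope e ℤ.* + ringPos d e k c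

  dirSign : Dir → ℤ
  dirSign fwd = 1ℤ
  dirSign bwd = - 1ℤ

  ringStep : Dir → GE → ℤ
  ringStep d e = slope e ℤ.* dirSign d

  ringStep-unit : ∀ d e → IsUnit (ringStep d e)
  ringStep-unit fwd e = isUnit-* (slope-unit e) unit⁺
  ringStep-unit bwd e = isUnit-* (slope-unit e) unit⁻

  ringHeightIn : GF → GE → ℕ → Bool → ℤ
  ringHeightIn f e = ringHeight (side f e) e

  ringStepIn : GF → GE → ℤ
  ringStepIn f e = ringStep (side f e) e

  ringStepIn-unit : ∀ f e → IsUnit (ringStepIn f e)
  ringStepIn-unit f e = ringStep-unit (side f e) e

  ringHeightIn-onBd : ∀ {f e d} → OnBd n f e d → ∀ k c → ringHeightIn f e k c ≡ ringHeight d e k c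
  ringHeightIn-onBd {e = e} ob k c = cong (λ d → ringHeight d e k c) (side-correct ob)

  affine-suc : ∀ b u t → b ℤ.+ u ℤ.* + suc t ≡ b ℤ.+ u ℤ.* + t ℤ.+ u ℤ.* 1ℤ
  affine-suc b u t rewrite pos-suc t = l b u (+ t)
    where l : ∀ b u t → b ℤ.+ u ℤ.* (1ℤ ℤ.+ t) ≡ b ℤ.+ u ℤ.* t ℤ.+ u ℤ.* 1ℤ
          l = solve-∀

  affine-pred : ∀ b u t → b ℤ.+ u ℤ.* + t ≡ b ℤ.+ u ℤ.* + suc t ℤ.+ u ℤ.* (- 1ℤ)
  affine-pred b u t rewrite pos-suc t = l b u (+ t)
    where l : ∀ b u t → b ℤ.+ u ℤ.* t ≡ b ℤ.+ u ℤ.* (1ℤ ℤ.+ t) ℤ.+ u ℤ.* (- 1ℤ)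
          l = solve-∀

  ringHeight-double : ∀ d e k → two φ d e k ≡ true →
                      ringHeight d e k true ≡ ringHeight d e k false ℤ.+ ringStep d e
  ringHeight-double fwd e k _ rewrite ℕₚ.+-comm (ringsBefore fwd e k) 1 | ℕₚ.+-identityʳ (ringsBefore fwd e k) =
    affine-suc (scaled (start e)) (slope e) (suc (ringsBefore fwd e k))
  ringHeight-double bwd e k doubled rewrite doubled | ℕₚ.+-identityʳ (ringsBefore bwd e k)
                                         | ℕₚ.+-comm (ringsBefore bwd e k) 1 =
    affine-pred (scaled (start e)) (slope e) (ringsBefore bwd e k)

  ringHeight-fwd-next : ∀ e k → ringHeight fwd e (suc k) false ≡ ringHeight fwd e k (two φ fwd e k) ℤ.+ ringStep fwd e
  ringHeight-fwd-next e k rewrite ringPos-fwd-last e k | ℕₚ.+-identityʳ (ringsBefore fwd e (suc k)) =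
    affine-suc (scaled (start e)) (slope e) (ringsBefore fwd e (suc k))

  ringHeight-bwd-next : ∀ e k → ringHeight bwd e k false ≡ ringHeight bwd e (suc k) (two φ bwd e (suc k)) ℤ.+ ringStep bwd e
  ringHeight-bwd-next e k rewrite ringPos-bwd-last e (suc k) | ringsBefore-bwd-suc e k =
    affine-pred (scaled (start e)) (slope e) (ringPos bwd e k false)

  ringHeight-last : ∀ d e → ringHeight d e (lst d) (two φ d e (lst d)) ≡ scaled (segEnd d e)
  ringHeight-last fwd e = begin
    scaled (start e) ℤ.+ slope e ℤ.* + ringPos fwd e (2 * s ∸ 1) (two φ fwd e (2 * s ∸ 1)) ≡⟨ cong (λ t → scaled (start e) ℤ.+ slope e ℤ.* + t) pos≡3s ⟩
    scaled (start e) ℤ.+ slope e ℤ.* + (3 * s)                      ≡⟨ sym (scaled-end e) ⟩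
    scaled (end e)                                                 ∎
    where
    open ≡-Reasoning
    pos≡3s : ringPos fwd e (2 * s ∸ 1) (two φ fwd e (2 * s ∸ 1)) ≡ 3 * s
    pos≡3s = trans (ringPos-fwd-last e (2 * s ∸ 1)) (trans (cong (ringsBefore fwd e) (suc[2s∸1]≡2s 1≤s)) (ringsBefore-3s fwd e s))
  ringHeight-last bwd e =
    trans (cong (λ t → scaled (start e) ℤ.+ slope e ℤ.* + t) (ringPos-bwd-last e 0))
          (trans (cong (λ t → scaled (start e) ℤ.+ t) (ℤₚ.*-zeroʳ (slope e))) (ℤₚ.+-identityʳ _))

  ringHeight-first : ∀ d e → ringHeight d e (fst d) false ≡ scaled (segStart d e) ℤ.+ ringStep d e
  ringHeight-first fwd e = refl
  ringHeight-first bwd e = begin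
    b ℤ.+ u ℤ.* + p                               ≡⟨ affine-pred b u p ⟩
    b ℤ.+ u ℤ.* + suc p ℤ.+ u ℤ.* (- 1ℤ)         ≡⟨ cong (λ t → b ℤ.+ u ℤ.* + t ℤ.+ u ℤ.* (- 1ℤ)) suc-p≡3s ⟩
    b ℤ.+ u ℤ.* + (3 * s) ℤ.+ u ℤ.* (- 1ℤ)       ≡⟨ cong (λ t → t ℤ.+ ringStep bwd e) (sym (scaled-end e)) ⟩
    scaled (end e) ℤ.+ ringStep bwd e            ∎
    where
    open ≡-Reasoning
    b = scaled (start e)
    u = slope e
    p = ringPos bwd e (2 * s ∸ 1) false
    suc-p≡3s : suc p ≡ 3 * s
    suc-p≡3s = trans (sym (ringsBefore-bwd-suc e (2 * s ∸ 1)))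
                     (trans (cong (ringsBefore bwd e) (suc[2s∸1]≡2s 1≤s)) (ringsBefore-3s bwd e s))

  ringHeight-succ : ∀ {f e k c e' k' c'} → RSucc f e k c e' k' c' →
                    ringHeightIn f e' k' c' ≡ ringHeightIn f e k c ℤ.+ ringStepIn f e'
  ringHeight-succ (rs-in {e} {d} {k} ob _ doubled) rewrite side-correct ob = ringHeight-double d e k doubled
  ringHeight-succ (rs-out {e} (ns-f {k = k} ob' _) ob refl)
    rewrite side-correct ob' | side-unique ob ob' = ringHeight-fwd-next e k
  ringHeight-succ (rs-out {e} (ns-b {k = k} ob' _) ob refl)
    rewrite side-correct ob' | side-unique ob ob' = ringHeight-bwd-next e k
  ringHeight-succ (rs-out {e} (ns-c {d = d} {e'} {d'} q) ob refl)
    rewrite side-correct (proj₁ (nextSeg-onBd q)) | side-correct (proj₂ (nextSeg-onBd q))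
          | side-unique ob (proj₁ (nextSeg-onBd q)) =
    trans (ringHeight-first d' e')
          (cong (λ t → t ℤ.+ ringStep d' e')
                (trans (cong scaled (sym (nextSeg-corner q))) (sym (ringHeight-last d e))))

  R : ℕ
  R = 3 * s * (n ∸ 1)

  centre : GF → ℤ
  centre (inner i j) = + (3 * s) ℤ.* (height (i , j) ℤ.+ halfSum σ₁ σ₂)
  centre outer       = + (3 * s) ℤ.* (+ (n ∸ 1) ℤ.* halfSum σ₁ σ₂)

  outer-corner-near : ∀ i j → i < n → j < n → Near R (scaled (i , j)) (centre outer)
  outer-corner-near i j i<n j<n =
    near-scale (3 * s) (signed-sum-near (n ∸ 1) σ₁ σ₂ i j (ℕₚ.∸-monoˡ-≤ 1 i<n) (ℕₚ.∸-monoˡ-≤ 1 j<n))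

  inner-corner-near : ∀ i j a b → a ≤ 1 → b ≤ 1 → Near R (scaled (a + i , b + j)) (centre (inner i j))
  inner-corner-near i j a b a≤1 b≤1 =
    near-weaken (ℕₚ.*-monoʳ-≤ (3 * s) 1≤n∸1) (near-scale (3 * s)
      (subst₂ (Near 1) (sym corner) (cong (λ t → height (i , j) ℤ.+ t) (ℤₚ.*-identityˡ (halfSum σ₁ σ₂)))
        (near-+ˡ (height (i , j)) (signed-sum-near 1 σ₁ σ₂ a b a≤1 b≤1))))
    where
    corner : height (a + i , b + j) ≡ height (i , j) ℤ.+ (⟦ σ₁ ⟧ ℤ.* + a ℤ.+ ⟦ σ₂ ⟧ ℤ.* + b)
    corner rewrite ℤₚ.pos-+ a i | ℤₚ.pos-+ b j = l ⟦ σ₁ ⟧ ⟦ σ₂ ⟧ (+ a) (+ i) (+ b) (+ j)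
      where l : ∀ u v a i b j → u ℤ.* (a ℤ.+ i) ℤ.+ v ℤ.* (b ℤ.+ j) ≡ u ℤ.* i ℤ.+ v ℤ.* j ℤ.+ (u ℤ.* a ℤ.+ v ℤ.* b)
            l = solve-∀

  endpoints-near : ∀ {f e d} → OnBd n f e d →
                   Near R (scaled (start e)) (centre f) × Near R (scaled (end e)) (centre f)
  endpoints-near (in-b {i} {j} _ _) = inner-corner-near i j 0 0 z≤n z≤n , inner-corner-near i j 0 1 z≤n ℕₚ.≤-refl
  endpoints-near (in-r {i} {j} _ _) = inner-corner-near i j 0 1 z≤n ℕₚ.≤-refl , inner-corner-near i j 1 1 ℕₚ.≤-refl ℕₚ.≤-refl
  endpoints-near (in-t {i} {j} _ _) = inner-corner-near i j 1 0 ℕₚ.≤-refl z≤n , inner-corner-near i j 1 1 ℕₚ.≤-refl ℕₚ.≤-refl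
  endpoints-near (in-l {i} {j} _ _) = inner-corner-near i j 0 0 z≤n z≤n , inner-corner-near i j 1 0 ℕₚ.≤-refl z≤n
  endpoints-near (out-l {i} p) = outer-corner-near i 0 (pred< p) 0<n , outer-corner-near (suc i) 0 p 0<n
  endpoints-near (out-t {j} p) = outer-corner-near (n ∸ 1) j n∸1<n (pred< p) , outer-corner-near (n ∸ 1) (suc j) n∸1<n p
  endpoints-near (out-r {i} p) = outer-corner-near i (n ∸ 1) (pred< p) n∸1<n , outer-corner-near (suc i) (n ∸ 1) p n∸1<n
  endpoints-near (out-b {j} p) = outer-corner-near 0 j 0<n (pred< p) , outer-corner-near 0 (suc j) 0<n p

  ringHeight-near-centre : ∀ {f e d k c} → OnBd n f e d → suc k ≤ 2 * s → (c ≡ true → two φ d e k ≡ true) →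
                           Near R (ringHeight d e k c) (centre f)
  ringHeight-near-centre {f} {e} {d} {k} {c} ob k<2s c⇒two =
    near-unit-between (slope-unit e) (scaled (start e)) (ringPos d e k c) (3 * s) (ringPos-≤ s d e k c k<2s c⇒two)
      (proj₁ (endpoints-near ob)) (subst (λ t → Near R t (centre f)) (scaled-end e) (proj₂ (endpoints-near ob)))

  nextSub-onBd : ∀ {f e k e' k'} → NextSub f e k e' k' → (∃ λ d → OnBd n f e d) × (∃ λ d → OnBd n f e' d)
  nextSub-onBd (ns-f p _) = (_ , p) , (_ , p)
  nextSub-onBd (ns-b p _) = (_ , p) , (_ , p)
  nextSub-onBd (ns-c q)   = (_ , proj₁ (nextSeg-onBd q)) , (_ , proj₂ (nextSeg-onBd q))

  1≤2s : 1 ≤ 2 * s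
  1≤2s = ℕₚ.≤-trans 1≤s (ℕₚ.m≤m+n s _)

  nextSub-bounds : ∀ {f e k e' k'} → NextSub f e k e' k' → suc k ≤ 2 * s × suc k' ≤ 2 * s
  nextSub-bounds (ns-f _ p) = ℕₚ.<⇒≤ p , p
  nextSub-bounds (ns-b _ p) = p , ℕₚ.<⇒≤ p
  nextSub-bounds (ns-c {d = d} {d' = d'} _) = last d , first d'
    where
    last : ∀ d → suc (lst d) ≤ 2 * s
    last fwd = ℕₚ.≤-reflexive (suc[2s∸1]≡2s 1≤s)
    last bwd = 1≤2s
    first : ∀ d → suc (fst d) ≤ 2 * s
    first fwd = 1≤2s
    first bwd = ℕₚ.≤-reflexive (suc[2s∸1]≡2s 1≤s)

  -- Face potential

  -- Ring ρ lies between the faces with clamp widths width ρ (inside) and width ρ + 1 (outside);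
  -- on ring 0 the outside width is r, so that shallow faces are never clamped.
  width : ℕ → ℕ
  width ρ = (r ∸ 1) ∸ ρ

  suc-width-0 : suc (width 0) ≡ r
  suc-width-0 = suc-∸1 (ℕₚ.≤-trans (s≤s z≤n) R<r)

  width-suc : ∀ ρ → suc ρ < r → width ρ ≡ suc (width (suc ρ))
  width-suc ρ sρ<r = ∸-suc (r ∸ 1) ρ (ℕₚ.∸-monoˡ-≤ 1 sρ<r)

  width-last : width (r ∸ 1) ≡ 0
  width-last = ℕₚ.n∸n≡0 (r ∸ 1)

  facePot : Face → ℤ
  facePot (tri f e k)      = ringHeightIn f e k false
  facePot (gap f e k)      = ringHeightIn f e k (two φ (side f e) e k)
  facePot (quad f ρ e k c) = clampAround (centre f) (width ρ) (ringHeightIn f e k c)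
  facePot (center f)       = centre f

  ringEdgePot : GF → ℕ → ℤ → ℤ
  ringEdgePot f ρ m = clampAround (centre f) (width ρ) m ⊓ clampAround (centre f) (suc (width ρ)) m

  matchEdgePot : GF → ℕ → GE → ℕ → Bool → ℤ
  matchEdgePot f ρ e k c = clampAround (centre f) (width ρ) (ringHeightIn f e k c)
                         ⊓ clampAround (centre f) (width ρ) (ringHeightIn f e k c - ringStepIn f e)

  attachEdgePot : GF → GE → ℕ → Bool → ℤ
  attachEdgePot f e k c = ringHeightIn f e k c ⊓ (ringHeightIn f e k c - ringStepIn f e)

  pathEdgePot : GE → ℕ → ℤ
  pathEdgePot e k = ringHeight fwd e k (two φ fwd e k) ⊓ ringHeight bwd e (suc k) (two φ bwd e (suc k))

  -- Pairs of vertices that are not adjacent get the junk value 0ℤ.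
  edgePot : V → V → ℤ
  edgePot (grid g)         (sub _ _)          = scaled g
  edgePot (sub _ _)        (grid g)           = scaled g
  edgePot (sub e k)        (sub _ k')         = pathEdgePot e (k ℕ.⊓ k')
  edgePot (sub _ _)        (ring f _ e k c)   = attachEdgePot f e k c
  edgePot (ring f _ e k c) (sub _ _)          = attachEdgePot f e k c
  edgePot (ring f ρ e k c) (ring f' ρ' e' k' c') =
    if ρ ≡ᵇ ρ' then ringEdgePot f ρ (ringHeightIn f e k c ⊓ ringHeightIn f' e' k' c')
    else if ρ <ᵇ ρ' then matchEdgePot f ρ e k c else matchEdgePot f' ρ' e' k' c'
  edgePot _ _ = 0ℤ

  unclamped : ∀ {f e d k c} → OnBd n f e d → suc k ≤ 2 * s → (c ≡ true → two φ d e k ≡ true) →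
              clampAround (centre f) (suc (width 0)) (ringHeightIn f e k c) ≡ ringHeightIn f e k c
  unclamped {f} {e} {d} {k} {c} ob k<2s c⇒two =
    trans (cong (λ w → clampAround (centre f) w (ringHeightIn f e k c)) suc-width-0)
          (subst (λ q → clampAround (centre f) r q ≡ q) (sym (ringHeightIn-onBd ob k c))
                 (clampAround-near-id (ℕₚ.<⇒≤ R<r) (ringHeight-near-centre ob k<2s c⇒two)))

  ringEdge-window : ∀ {f e k c e' k' c'} ρ → RSucc f e k c e' k' c' →
    InWindow (ringEdgePot f ρ (ringHeightIn f e k c ⊓ ringHeightIn f e' k' c'))
             (clampAround (centre f) (width ρ) (ringHeightIn f e k c)) ×
    InWindow (ringEdgePot f ρ (ringHeightIn f e k c ⊓ ringHeightIn f e' k' c'))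
             (clampAround (centre f) (suc (width ρ)) (ringHeightIn f e k c))
  ringEdge-window {f} {e' = e'} ρ rs rewrite ringHeight-succ rs =
    clampAround-window-unit (ringStepIn-unit f e') (centre f) (width ρ) _

  matchEdge-window : ∀ f ρ e k c →
    InWindow (matchEdgePot f ρ e k c) (clampAround (centre f) (width ρ) (ringHeightIn f e k c)) ×
    InWindow (matchEdgePot f ρ e k c) (clampAround (centre f) (width ρ) (ringHeightIn f e k c - ringStepIn f e))
  matchEdge-window f ρ e k c =
    near⇒inWindow-⊓ (clampAround-near (centre f) (width ρ) (near-unit-back (ringStepIn-unit f e) _))

  attachEdge-window : ∀ f e k c →
    InWindow (attachEdgePot f e k c) (ringHeightIn f e k c) ×
    InWindow (attachEdgePot f e k c) (ringHeightIn f e k c - ringStepIn f e)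
  attachEdge-window f e k c = near⇒inWindow-⊓ (near-unit-back (ringStepIn-unit f e) _)

  across-edge-near : ∀ e k → Near 1 (ringHeight fwd e k (two φ fwd e k)) (ringHeight bwd e (suc k) (two φ bwd e (suc k)))
  across-edge-near e k rewrite ringPos-fwd-last e k | ringPos-bwd-last e (suc k) =
    near-+ˡ (scaled (start e)) (near-unit-* (slope-unit e) (across-near e (suc k)))

  back-step : ∀ {f e k c e' k' c'} → RSucc f e k c e' k' c' →
              ringHeightIn f e' k' c' - ringStepIn f e' ≡ ringHeightIn f e k c
  back-step {f} {e} {k} {c} {e'} rs = trans (cong (_- ringStepIn f e') (ringHeight-succ rs)) (l _ _)
    where l : ∀ x u → x ℤ.+ u - u ≡ x
          l = solve-∀

  gapPot : ∀ {f e d} k → OnBd n f e d → facePot (gap f e k) ≡ ringHeight d e k (two φ d e k)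
  gapPot {f} {e} k ob = cong (λ d → ringHeight d e k (two φ d e k)) (side-correct ob)

  gapPot-last : ∀ {f e d} k → OnBd n f e d → ringHeightIn f e k (two φ d e k) ≡ facePot (gap f e k)
  gapPot-last k ob = trans (ringHeightIn-onBd ob k _) (sym (gapPot k ob))

  facePot-inWindow : ∀ {F x y} → FE F x y → InWindow (edgePot x y) (facePot F)
  facePot-inWindow (fe-tri1 {f} {e} {k = k} _ _ _) = proj₁ (attachEdge-window f e k false)
  facePot-inWindow (fe-tri2 {f} {e} {k = k} ob k<2s doubled) =
    subst (InWindow _) (unclamped ob k<2s λ ()) (proj₂ (ringEdge-window 0 (rs-in ob k<2s doubled)))
  facePot-inWindow (fe-tri3 {f} {e} {k = k} ob k<2s doubled) =
    subst (InWindow _) (back-step (rs-in ob k<2s doubled)) (proj₂ (attachEdge-window f e k true))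
  facePot-inWindow (fe-gap1 {f} {e} {d} {k} _ ob) =
    subst (InWindow _) (gapPot-last k ob) (proj₁ (attachEdge-window f e k (two φ d e k)))
  facePot-inWindow (fe-gap2 {f} {e} {d} {k} ns ob) =
    subst (InWindow _) (trans (unclamped ob (proj₁ (nextSub-bounds ns)) (λ p → p)) (gapPot-last k ob))
      (proj₂ (ringEdge-window 0 (rs-out ns ob refl)))
  facePot-inWindow (fe-gap3 {f} {e} {k} {e'} {k'} ns) with proj₁ (nextSub-onBd ns)
  ... | d , ob = subst (InWindow _) (trans (back-step (rs-out ns ob refl)) (gapPot-last k ob))
                   (proj₂ (attachEdge-window f e' k' false))
  facePot-inWindow (fe-gapf {e = e} {k} ob _) rewrite side-correct ob | ℕₚ.m≤n⇒m⊓n≡m (ℕₚ.n≤1+n k) =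
    proj₁ (near⇒inWindow-⊓ (across-edge-near e k))
  facePot-inWindow (fe-gapb {e = e} {k} ob _) rewrite side-correct ob | ℕₚ.m≥n⇒m⊓n≡n (ℕₚ.n≤1+n k) =
    proj₂ (near⇒inWindow-⊓ (across-edge-near e k))
  facePot-inWindow (fe-gapc1 {e = e} {d} q) =
    subst (InWindow _) (sym (trans (gapPot (lst d) (proj₁ (nextSeg-onBd q))) (ringHeight-last d e))) (inWindow-refl _)
  facePot-inWindow (fe-gapc2 {e = e} {d} q) =
    subst (InWindow _) (sym (trans (gapPot (lst d) (proj₁ (nextSeg-onBd q))) (ringHeight-last d e))) (inWindow-refl _)
  facePot-inWindow (fe-q1 {ρ = ρ} _ rs) rewrite ≡ᵇ-refl ρ = proj₁ (ringEdge-window ρ rs)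
  facePot-inWindow (fe-q2 {f} {ρ} {e} {k} {c} sρ<r rs) rewrite ≡ᵇ-refl ρ =
    subst (InWindow _) (cong (λ w → clampAround (centre f) w (ringHeightIn f e k c)) (sym (width-suc ρ sρ<r)))
      (proj₂ (ringEdge-window (suc ρ) rs))
  facePot-inWindow (fe-q3 {f} {ρ} {e} {k} {c} _ _) rewrite ≡ᵇ-suc ρ | <ᵇ-suc ρ =
    proj₁ (matchEdge-window f ρ e k c)
  facePot-inWindow (fe-q4 {f} {ρ} {e' = e'} {k'} {c'} _ rs) rewrite ≡ᵇ-suc ρ | <ᵇ-suc ρ =
    subst (InWindow _) (cong (clampAround (centre f) (width ρ)) (back-step rs)) (proj₂ (matchEdge-window f ρ e' k' c'))
  facePot-inWindow (fe-c {f} {e} {k} {c} rs) rewrite ≡ᵇ-refl (r ∸ 1) =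
    subst (InWindow _) (trans (cong (λ w → clampAround (centre f) w (ringHeightIn f e k c)) width-last)
                              (clampAround-zero (centre f) _))
      (proj₁ (ringEdge-window (r ∸ 1) rs))

  edgePot-sym : ∀ {F x y} → FE F x y → edgePot x y ≡ edgePot y x
  edgePot-sym (fe-tri1 _ _ _)           = refl
  edgePot-sym (fe-tri2 {f} _ _ _)       = cong (ringEdgePot f 0) (ℤₚ.⊓-comm _ _)
  edgePot-sym (fe-tri3 _ _ _)           = refl
  edgePot-sym (fe-gap1 _ _)             = refl
  edgePot-sym (fe-gap2 {f} _ _)         = cong (ringEdgePot f 0) (ℤₚ.⊓-comm _ _)
  edgePot-sym (fe-gap3 _)               = refl
  edgePot-sym (fe-gapf {e = e} {k} _ _) = cong (pathEdgePot e) (ℕₚ.⊓-comm k (suc k))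
  edgePot-sym (fe-gapb {e = e} {k} _ _) = cong (pathEdgePot e) (ℕₚ.⊓-comm (suc k) k)
  edgePot-sym (fe-gapc1 _)              = refl
  edgePot-sym (fe-gapc2 _)              = refl
  edgePot-sym (fe-q1 {f} {ρ} _ _)       rewrite ≡ᵇ-refl ρ = cong (ringEdgePot f ρ) (ℤₚ.⊓-comm _ _)
  edgePot-sym (fe-q2 {f} {ρ} _ _)       rewrite ≡ᵇ-refl ρ = cong (ringEdgePot f (suc ρ)) (ℤₚ.⊓-comm _ _)
  edgePot-sym (fe-q3 {ρ = ρ} _ _)       rewrite ≡ᵇ-suc ρ | <ᵇ-suc ρ | suc-≡ᵇ ρ | suc-<ᵇ ρ = refl
  edgePot-sym (fe-q4 {ρ = ρ} _ _)       rewrite ≡ᵇ-suc ρ | <ᵇ-suc ρ | suc-≡ᵇ ρ | suc-<ᵇ ρ = refl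
  edgePot-sym (fe-c {f} _)              rewrite ≡ᵇ-refl (r ∸ 1) = cong (ringEdgePot f (r ∸ 1)) (ℤₚ.⊓-comm _ _)

  facePot-dual-near : ∀ {F G} → DualAdj F G → Near 1 (facePot F) (facePot G)
  facePot-dual-near (x , y , onF , onG) = inWindow-near (inWindow onF) (inWindow onG)
    where
    inWindow : ∀ {F} → OnF F x y → InWindow (edgePot x y) (facePot F)
    inWindow (inj₁ fe) = facePot-inWindow fe
    inWindow (inj₂ fe) = subst (λ l → InWindow l _) (edgePot-sym fe) (facePot-inWindow fe)

  -- Vertex potential

  vertexPot : V → ℤ
  vertexPot (grid g)         = + 2 ℤ.* scaled g
  vertexPot (sub e k)        = + 2 ℤ.* scaled (start e) ℤ.+ slope e ℤ.* + (3 * k + 2)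
  vertexPot (ring f _ e k c) = + 2 ℤ.* ringHeightIn f e k c

  double-affine : ∀ b u t → + 2 ℤ.* (b ℤ.+ u ℤ.* + t) ≡ + 2 ℤ.* b ℤ.+ u ℤ.* + (2 * t)
  double-affine b u t = trans (l b u (+ t)) (cong (λ z → + 2 ℤ.* b ℤ.+ u ℤ.* z) (sym (ℤₚ.pos-* 2 t)))
    where l : ∀ b u t → + 2 ℤ.* (b ℤ.+ u ℤ.* t) ≡ + 2 ℤ.* b ℤ.+ u ℤ.* (+ 2 ℤ.* t)
          l = solve-∀

  affine-near : ∀ e {a b} → Near 3 (+ a) (+ b) →
                Near 3 (+ 2 ℤ.* scaled (start e) ℤ.+ slope e ℤ.* + a) (+ 2 ℤ.* scaled (start e) ℤ.+ slope e ℤ.* + b)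
  affine-near e ab = near-+ˡ (+ 2 ℤ.* scaled (start e)) (near-unit-* (slope-unit e) ab)

  attach-vertex-near : ∀ d e k c → Near 3 (vertexPot (sub e k)) (+ 2 ℤ.* ringHeight d e k c)
  attach-vertex-near d e k c =
    subst (Near 3 _) (sym (double-affine (scaled (start e)) (slope e) (ringPos d e k c)))
      (affine-near e (attach-near d e k c))

  corner-vertex-near : ∀ d e → Near 3 (+ 2 ℤ.* scaled (segStart d e)) (vertexPot (sub e (fst d)))
  corner-vertex-near fwd e = near-unit-multiple (slope-unit e) (+ 2 ℤ.* scaled (start e)) 2 (ℕₚ.n≤1+n 2)
  corner-vertex-near bwd e =
    near-sym (subst (Near 3 _) (sym end≡) (near-unit-multiple (slope-unit e) (vertexPot (sub e (2 * s ∸ 1))) 1 z≤n′))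
    where
    z≤n′ : 1 ≤ 3
    z≤n′ = s≤s z≤n
    m = 3 * (2 * s ∸ 1) + 2
    m+1≡6s : m + 1 ≡ 2 * (3 * s)
    m+1≡6s = trans (l (2 * s ∸ 1)) (trans (cong (3 *_) (suc[2s∸1]≡2s 1≤s)) (l′ s))
      where l : ∀ t → 3 * t + 2 + 1 ≡ 3 * suc t
            l = ℕ-solve
            l′ : ∀ s → 3 * (2 * s) ≡ 2 * (3 * s)
            l′ = ℕ-solve
    end≡ : + 2 ℤ.* scaled (end e) ≡ vertexPot (sub e (2 * s ∸ 1)) ℤ.+ slope e ℤ.* + 1
    end≡ = begin
      + 2 ℤ.* scaled (end e)                                        ≡⟨ cong (+ 2 ℤ.*_) (scaled-end e) ⟩
      + 2 ℤ.* (scaled (start e) ℤ.+ slope e ℤ.* + (3 * s))         ≡⟨ double-affine (scaled (start e)) (slope e) (3 * s) ⟩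
      + 2 ℤ.* scaled (start e) ℤ.+ slope e ℤ.* + (2 * (3 * s))     ≡⟨ cong (λ t → + 2 ℤ.* scaled (start e) ℤ.+ slope e ℤ.* + t) (sym m+1≡6s) ⟩
      + 2 ℤ.* scaled (start e) ℤ.+ slope e ℤ.* (+ m ℤ.+ + 1)       ≡⟨ l (+ 2 ℤ.* scaled (start e)) (slope e) (+ m) ⟩
      vertexPot (sub e (2 * s ∸ 1)) ℤ.+ slope e ℤ.* + 1             ∎
      where
      open ≡-Reasoning
      l : ∀ b u m → b ℤ.+ u ℤ.* (m ℤ.+ + 1) ≡ b ℤ.+ u ℤ.* m ℤ.+ u ℤ.* + 1
      l = solve-∀

  ring-vertex-near : ∀ {f e k c e' k' c'} → RSucc f e k c e' k' c' →
                     Near 3 (+ 2 ℤ.* ringHeightIn f e k c) (+ 2 ℤ.* ringHeightIn f e' k' c')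
  ring-vertex-near {f} {e} {k} {c} {e'} rs =
    subst (Near 3 _) (sym (trans (cong (+ 2 ℤ.*_) (ringHeight-succ rs)) (l (ringHeightIn f e k c) (ringStepIn f e'))))
      (near-unit-multiple (ringStepIn-unit f e') (+ 2 ℤ.* ringHeightIn f e k c) 2 (ℕₚ.n≤1+n 2))
    where l : ∀ q u → + 2 ℤ.* (q ℤ.+ u) ≡ + 2 ℤ.* q ℤ.+ u ℤ.* + 2
          l = solve-∀

  gap-vertex-near : ∀ {f e k e' k' d} → NextSub f e k e' k' → OnBd n f e d →
                    Near 3 (+ 2 ℤ.* ringHeight d e k (two φ d e k)) (vertexPot (sub e' k'))
  gap-vertex-near {e = e} (ns-f {k = k} ob' _) ob rewrite side-unique ob ob' | ringPos-fwd-last e k =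
    subst (λ t → Near 3 t (vertexPot (sub e (suc k)))) (sym (double-affine (scaled (start e)) (slope e) (ringsBefore fwd e (suc k)))) (affine-near e (gap-fwd-near e k))
  gap-vertex-near {e = e} (ns-b {k = k} ob' _) ob rewrite side-unique ob ob' | ringPos-bwd-last e (suc k) =
    subst (λ t → Near 3 t (vertexPot (sub e k))) (sym (double-affine (scaled (start e)) (slope e) (ringsBefore bwd e (suc k)))) (affine-near e (gap-bwd-near e k))
  gap-vertex-near {e = e} (ns-c {d = d} {d' = d'} q) ob rewrite side-unique ob (proj₁ (nextSeg-onBd q)) =
    subst (λ t → Near 3 (+ 2 ℤ.* t) _) (trans (cong scaled (sym (nextSeg-corner q))) (sym (ringHeight-last d e)))
      (corner-vertex-near d' _)

  vertexPot-edge-near : ∀ {x y} → E x y → Near 3 (vertexPot x) (vertexPot y)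
  vertexPot-edge-near (e-start {e} _)       = corner-vertex-near fwd e
  vertexPot-edge-near (e-path {e} {k} _ _) =
    subst (Near 3 _) (sym next≡) (near-unit-multiple (slope-unit e) (vertexPot (sub e k)) 3 ℕₚ.≤-refl)
    where
    next≡ : vertexPot (sub e (suc k)) ≡ vertexPot (sub e k) ℤ.+ slope e ℤ.* + 3
    next≡ = trans (cong (λ t → + 2 ℤ.* scaled (start e) ℤ.+ slope e ℤ.* + t) (lₙ k)) (l (+ 2 ℤ.* scaled (start e)) (slope e) (+ (3 * k + 2)))
      where lₙ : ∀ k → 3 * suc k + 2 ≡ 3 * k + 2 + 3
            lₙ = ℕ-solve
            l : ∀ b u m → b ℤ.+ u ℤ.* (m ℤ.+ + 3) ≡ b ℤ.+ u ℤ.* m ℤ.+ u ℤ.* + 3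
            l = solve-∀
  vertexPot-edge-near (e-end {e} _)         = near-sym (corner-vertex-near bwd e)
  vertexPot-edge-near (e-ring _ rs)         = ring-vertex-near rs
  vertexPot-edge-near (e-match _ _)         = near-refl 3 _
  vertexPot-edge-near (e-att {f} {e} {k} {c} _) = attach-vertex-near (side f e) e k c

  vertexPot-adj-near : ∀ {x y} → Adj x y → Near 3 (vertexPot x) (vertexPot y)
  vertexPot-adj-near (inj₁ xy) = vertexPot-edge-near xy
  vertexPot-adj-near (inj₂ yx) = near-sym (vertexPot-edge-near yx)

  via-gap : ∀ {f e d k z} → OnBd n f e d →
            Near 3 (+ 2 ℤ.* ringHeight d e k (two φ d e k)) z → Near 3 (+ 2 ℤ.* facePot (gap f e k)) z
  via-gap {k = k} ob = subst (λ t → Near 3 (+ 2 ℤ.* t) _) (sym (gapPot k ob))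

  via-gapIn : ∀ {f e d k z} → OnBd n f e d →
              Near 3 (+ 2 ℤ.* ringHeightIn f e k (two φ d e k)) z → Near 3 (+ 2 ℤ.* facePot (gap f e k)) z
  via-gapIn {k = k} ob = subst (λ t → Near 3 (+ 2 ℤ.* t) _) (gapPot-last k ob)

  data TriOrGap : Face → Set where
    is-tri : ∀ {f e k} → TriOrGap (tri f e k)
    is-gap : ∀ {f e k} → TriOrGap (gap f e k)

  sub-on-boundary : ∀ {F e k} → OnBoundary F (sub e k) → TriOrGap F × ValidGE n e × suc k ≤ 2 * s
  sub-on-boundary (_ , inj₁ fe) = first fe
    where
    first : ∀ {F e k y} → FE F (sub e k) y → TriOrGap F × ValidGE n e × suc k ≤ 2 * s
    first (fe-tri1 ob k<2s _) = is-tri , onBd-valid ob , k<2s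
    first (fe-gap1 ns ob)     = is-gap , onBd-valid ob , proj₁ (nextSub-bounds ns)
    first (fe-gapf ob k<2s)   = is-gap , onBd-valid ob , ℕₚ.<⇒≤ k<2s
    first (fe-gapb ob k<2s)   = is-gap , onBd-valid ob , k<2s
    first (fe-gapc1 q)        = is-gap , onBd-valid (proj₁ (nextSeg-onBd q)) , proj₁ (nextSub-bounds (ns-c q))
  sub-on-boundary (_ , inj₂ fe) = second fe
    where
    second : ∀ {F e k x} → FE F x (sub e k) → TriOrGap F × ValidGE n e × suc k ≤ 2 * s
    second (fe-tri3 ob k<2s _) = is-tri , onBd-valid ob , k<2s
    second (fe-gap3 ns)        = is-gap , onBd-valid (proj₂ (proj₂ (nextSub-onBd ns))) , proj₂ (nextSub-bounds ns)
    second (fe-gapf ob k<2s)   = is-gap , onBd-valid ob , k<2s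
    second (fe-gapb ob k<2s)   = is-gap , onBd-valid ob , ℕₚ.<⇒≤ k<2s
    second (fe-gapc2 q)        = is-gap , onBd-valid (proj₂ (nextSeg-onBd q)) , proj₂ (nextSub-bounds (ns-c q))

  corner-near : ∀ {f e d e' d'} → NextSeg n f e d e' d' →
                Near 3 (+ 2 ℤ.* facePot (gap f e (lst d))) (vertexPot (grid (segEnd d e)))
  corner-near {e = e} {d} q =
    via-gap (proj₁ (nextSeg-onBd q))
      (subst (λ t → Near 3 (+ 2 ℤ.* t) (+ 2 ℤ.* scaled (segEnd d e))) (sym (ringHeight-last d e)) (near-refl 3 _))

  boundary-edge-near : ∀ {F x y} → TriOrGap F → FE F x y →
                       Near 3 (+ 2 ℤ.* facePot F) (vertexPot x) × Near 3 (+ 2 ℤ.* facePot F) (vertexPot y)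
  boundary-edge-near is-tri (fe-tri1 {f} {e} {k = k} _ _ _)     =
    near-sym (attach-vertex-near (side f e) e k false) , near-refl 3 _
  boundary-edge-near is-tri (fe-tri2 ob k<2s doubled)            =
    near-refl 3 _ , ring-vertex-near (rs-in ob k<2s doubled)
  boundary-edge-near is-tri (fe-tri3 {f} {e} {k = k} ob k<2s doubled) =
    ring-vertex-near (rs-in ob k<2s doubled) , near-sym (attach-vertex-near (side f e) e k false)
  boundary-edge-near is-gap (fe-gap1 {f} {e} {k = k} _ ob)        =
    near-sym (attach-vertex-near (side f e) e k _) , via-gapIn ob (near-refl 3 _)
  boundary-edge-near is-gap (fe-gap2 ns ob)                       =
    via-gapIn ob (near-refl 3 _) , via-gapIn ob (ring-vertex-near (rs-out ns ob refl))
  boundary-edge-near is-gap (fe-gap3 ns) with proj₁ (nextSub-onBd ns)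
  ... | _ , ob = via-gapIn ob (ring-vertex-near (rs-out ns ob refl)) , via-gap ob (gap-vertex-near ns ob)
  boundary-edge-near is-gap (fe-gapf {f} {e} {k} ob k<2s)         =
    near-sym (attach-vertex-near (side f e) e k _) , via-gap ob (gap-vertex-near (ns-f ob k<2s) ob)
  boundary-edge-near is-gap (fe-gapb {f} {e} {k} ob k<2s)         =
    near-sym (attach-vertex-near (side f e) e (suc k) _) , via-gap ob (gap-vertex-near (ns-b ob k<2s) ob)
  boundary-edge-near is-gap (fe-gapc1 {f} {e} {d} q)              =
    near-sym (attach-vertex-near (side f e) e (lst d) _) , corner-near q
  boundary-edge-near is-gap (fe-gapc2 q)                          =
    corner-near q , via-gap (proj₁ (nextSeg-onBd q)) (gap-vertex-near (ns-c q) (proj₁ (nextSeg-onBd q)))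

  boundary-near : ∀ {F x} → TriOrGap F → OnBoundary F x → Near 3 (+ 2 ℤ.* facePot F) (vertexPot x)
  boundary-near tg (_ , inj₁ fe) = proj₁ (boundary-edge-near tg fe)
  boundary-near tg (_ , inj₂ fe) = proj₂ (boundary-edge-near tg fe)

  open SubdividedWalks n s r φ 1≤s using (nearby-grid)

  closest-near : ∀ {F g} → Shallow F → Closest F g → Near (6 * s) (+ 2 ℤ.* facePot F) (vertexPot (grid g))
  closest-near (e , k , onF) (_ , closest) with sub-on-boundary onF
  ... | tg , val , k<2s with nearby-grid val k<2s
  ... | g' , valid' , m , m≤s , w with closest g' valid' s (sub e k , m , onF , m≤s , w)
  ... | x , m' , onF' , m'≤s , w' =
    near-weaken bound (near-trans (boundary-near tg onF') (near-sym (walk-near vertexPot vertexPot-adj-near w')))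
    where
    bound : 3 + m' * 3 ≤ 6 * s
    bound = ℕₚ.≤-trans (ℕₚ.+-mono-≤ (ℕₚ.*-monoʳ-≤ 3 1≤s) (ℕₚ.*-monoˡ-≤ 3 m'≤s)) (ℕₚ.≤-reflexive (l s))
      where l : ∀ s → 3 * s + s * 3 ≡ 6 * s
            l = ℕ-solve

  closest-gap : ∀ {a b ga gb k} → Shallow a → Shallow b → Closest a ga → Closest b gb →
                Walk DualAdj a b k → vertexPot (grid ga) ℤ.≤ vertexPot (grid gb) ℤ.+ + (6 * s + (2 * (k * 1) + 6 * s))
  closest-gap sha shb cla clb w =
    proj₁ (near-trans (near-sym (closest-near sha cla))
            (near-trans (near-scale 2 (walk-near facePot facePot-dual-near w)) (closest-near shb clb)))

  vertexPot-grid-drop : ∀ g g' D → height g ≡ height g' ℤ.+ + D →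
                        vertexPot (grid g) ≡ vertexPot (grid g') ℤ.+ + (2 * (3 * s * D))
  vertexPot-grid-drop g g' D drop = begin
    + 2 ℤ.* (+ (3 * s) ℤ.* height g)                                     ≡⟨ cong (λ t → + 2 ℤ.* (+ (3 * s) ℤ.* t)) drop ⟩
    + 2 ℤ.* (+ (3 * s) ℤ.* (height g' ℤ.+ + D))                          ≡⟨ l (+ 2) (+ (3 * s)) (height g') (+ D) ⟩
    + 2 ℤ.* (+ (3 * s) ℤ.* height g') ℤ.+ + 2 ℤ.* (+ (3 * s) ℤ.* + D)   ≡⟨ cong (λ t → vertexPot (grid g') ℤ.+ t) pos≡ ⟩
    vertexPot (grid g') ℤ.+ + (2 * (3 * s * D))                           ∎
    where
    open ≡-Reasoning
    l : ∀ a b x y → a ℤ.* (b ℤ.* (x ℤ.+ y)) ≡ a ℤ.* (b ℤ.* x) ℤ.+ a ℤ.* (b ℤ.* y)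
    l = solve-∀
    pos≡ : + 2 ℤ.* (+ (3 * s) ℤ.* + D) ≡ + (2 * (3 * s * D))
    pos≡ = trans (cong (+ 2 ℤ.*_) (sym (ℤₚ.pos-* (3 * s) D))) (sym (ℤₚ.pos-* 2 (3 * s * D)))

  dual-walk-bound : ∀ {a b ga gb k} D → height ga ≡ height gb ℤ.+ + D →
                    Shallow a → Shallow b → Closest a ga → Closest b gb → Walk DualAdj a b k → 3 * s * (D ∸ 2) ≤ k
  dual-walk-bound {ga = ga} {gb} {k} D drop sha shb cla clb w = begin
    3 * s * (D ∸ 2)       ≡⟨ ℕₚ.*-distribˡ-∸ (3 * s) D 2 ⟩
    3 * s * D ∸ 3 * s * 2 ≤⟨ ℕₚ.m≤n+o⇒m∸n≤o (3 * s * D) (3 * s * 2) halved ⟩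
    k                     ∎
    where
    open ℕₚ.≤-Reasoning
    doubled-bound : 2 * (3 * s * D) ≤ 6 * s + (2 * (k * 1) + 6 * s)
    doubled-bound = ℤₚ.drop‿+≤+ (+-cancelˡ-≤ (vertexPot (grid gb))
      (subst (ℤ._≤ vertexPot (grid gb) ℤ.+ + (6 * s + (2 * (k * 1) + 6 * s))) (vertexPot-grid-drop ga gb D drop)
             (closest-gap sha shb cla clb w)))
    l : ∀ s k → 6 * s + (2 * (k * 1) + 6 * s) ≡ 2 * (3 * s * 2 + k)
    l = ℕ-solve
    halved : 3 * s * D ≤ 3 * s * 2 + k
    halved = ℕₚ.*-cancelˡ-≤ 2 (ℕₚ.≤-trans doubled-bound (ℕₚ.≤-reflexive (l s k)))

-- Choosing the signs

towards : ℕ → ℕ → Sign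
towards a b with b ℕ.≤? a
... | yes _ = Sign.+
... | no  _ = Sign.-

towards-diff : ∀ a b → ⟦ towards a b ⟧ ℤ.* + a - ⟦ towards a b ⟧ ℤ.* + b ≡ + ∣ a - b ∣
towards-diff a b with b ℕ.≤? a
... | yes b≤a = begin
  1ℤ ℤ.* + a - 1ℤ ℤ.* + b ≡⟨ cong₂ _-_ (ℤₚ.*-identityˡ (+ a)) (ℤₚ.*-identityˡ (+ b)) ⟩
  + a - + b               ≡⟨ ℤₚ.m-n≡m⊖n a b ⟩
  a ℤ.⊖ b                 ≡⟨ ℤₚ.⊖-≥ b≤a ⟩
  + (a ∸ b)               ≡⟨ cong +_ (sym (ℕₚ.m≤n⇒∣n-m∣≡n∸m b≤a)) ⟩
  + ∣ a - b ∣             ∎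
  where open ≡-Reasoning
... | no b≰a = begin
  - 1ℤ ℤ.* + a - - 1ℤ ℤ.* + b ≡⟨ l (+ a) (+ b) ⟩
  + b - + a                   ≡⟨ ℤₚ.m-n≡m⊖n b a ⟩
  b ℤ.⊖ a                     ≡⟨ ℤₚ.⊖-≥ a≤b ⟩
  + (b ∸ a)                   ≡⟨ cong +_ (sym (ℕₚ.m≤n⇒∣m-n∣≡n∸m a≤b)) ⟩
  + ∣ a - b ∣                 ∎
  where
  open ≡-Reasoning
  a≤b : a ≤ b
  a≤b = ℕₚ.<⇒≤ (ℕₚ.≰⇒> b≰a)
  l : ∀ a b → - 1ℤ ℤ.* a - - 1ℤ ℤ.* b ≡ b - a
  l = solve-∀

towards-height : ∀ ia ja ib jb →
  ⟦ towards ia ib ⟧ ℤ.* + ia ℤ.+ ⟦ towards ja jb ⟧ ℤ.* + ja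
  ≡ ⟦ towards ia ib ⟧ ℤ.* + ib ℤ.+ ⟦ towards ja jb ⟧ ℤ.* + jb ℤ.+ + (∣ ia - ib ∣ + ∣ ja - jb ∣)
towards-height ia ja ib jb =
  trans (l ⟦ towards ia ib ⟧ ⟦ towards ja jb ⟧ (+ ia) (+ ja) (+ ib) (+ jb))
        (cong (λ t → ⟦ towards ia ib ⟧ ℤ.* + ib ℤ.+ ⟦ towards ja jb ⟧ ℤ.* + jb ℤ.+ t)
              (cong₂ ℤ._+_ (towards-diff ia ib) (towards-diff ja jb)))
  where l : ∀ u v ia ja ib jb → u ℤ.* ia ℤ.+ v ℤ.* ja
                              ≡ u ℤ.* ib ℤ.+ v ℤ.* jb ℤ.+ ((u ℤ.* ia - u ℤ.* ib) ℤ.+ (v ℤ.* ja - v ℤ.* jb))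
        l = solve-∀

lemma7 : (n s r : ℕ) (φ : GE → Bool) → 3 ≤ n → 1 ≤ s → 1 ≤ r → 3 * s * (n ∸ 1) < r →
    (a b : Face) (va vb : ℕ × ℕ) (d : ℕ) →
    Constr.Shallow n s r φ a → Constr.Shallow n s r φ b →
    Constr.Closest n s r φ a va → Constr.Closest n s r φ b vb →
    IsDist (GridAdj n) va vb d →
    (∃[ k ] (k ≤ (2 * s + 1) * d × Walk (Constr.Adj n s r φ) (grid va) (grid vb) k)) ×
    (∀ k → Walk (Constr.DualAdj n s r φ) a b k → 3 * s * (d ∸ 2) ≤ k)
lemma7 n s r φ 3≤n 1≤s _ R<r a b va@(ia , ja) vb@(ib , jb) d sha shb cla clb (grid-walk , shortest) =
  (_ , ℕₚ.≤-refl , grid-walk-lift grid-walk) ,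
  λ k w → ℕₚ.≤-trans (ℕₚ.*-monoʳ-≤ (3 * s) (ℕₚ.∸-monoˡ-≤ 2 d≤D))
                     (dual-walk-bound D (towards-height ia ja ib jb) sha shb cla clb w)
  where
  open SubdividedWalks n s r φ 1≤s using (grid-walk-lift)
  open Potential n s r φ (towards ia ib) (towards ja jb) (ℕₚ.≤-trans (ℕₚ.n≤1+n 2) 3≤n) 1≤s R<r
    using (dual-walk-bound)
  D = ∣ ia - ib ∣ + ∣ ja - jb ∣
  d≤D : d ≤ D
  d≤D = shortest D (grid-path va vb (proj₁ cla) (proj₁ clb))
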